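{- Let $\Gamma\Rightarrow\Delta$ be a sequent such that ${\sf G}^{1}{\sf LC}\vdash\Gamma\Rightarrow\Delta$. Then for every complete Boolean algebra $\mathbb{B}$ and every semi ${\tt D}\mathbb{B}$-valuation $V$, \[ \inf\{\Box V(A):A\in\Gamma\}\leq\sup\{\Diamond V(B): B\in\Delta\} \] (equivalently, $\Diamond V(\bigwedge\Gamma\supset\bigvee\Delta)=1$).
   Context: Language: a second-order language with no relation, function or constant symbols. First-order terms are the first-order variables; $Tm_{0}$ is the set of first-order terms. For each $n\geq1$ there are countably many $n$-ary second-order variables $X^{n}$; atomic formulas are $X^{n}(t_{1},\ldots,t_{n})$. Formulas are built with $\lnot,\lor,\land$, first-order quantifiers $\exists x,\forall x$ and second-order quantifiers $\exists X^{n},\forall X^{n}$. An $n$-ary abstract is $\lambda\vec{x}.G$ with $G$ a formula and $\vec{x}=(x_1,\dots,x_n)$ distinct variables; $Tm_{1}^{(n)}$ is the set of $n$-ary abstracts. For a formula $F(X^{n})$ and $T=\lambda\vec x.G$, $F(T)$ is obtained (up to renaming bound variables) by replacing each atomic $X(t_{1},\ldots,t_{n})$ by $G(t_{1},\ldots,t_{n})$. A sequent $\Gamma\Rightarrow\Delta$ is a pair of finite sets of formulas ($\Gamma,A$ means $\Gamma\cup\{A\}$). The calculus ${\sf G}^{1}{\sf LC}$: initial sequents $A,\Gamma\Rightarrow\Delta,A$ for $A$ atomic; rules (premise(s) / conclusion): $(L\lnot)$ $\lnot F,\Gamma\Rightarrow\Delta,F$ / $\lnot F,\Gamma\Rightarrow\Delta$;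 $(R\lnot)$ $F,\Gamma\Rightarrow\Delta,\lnot F$ / $\Gamma\Rightarrow\Delta,\lnot F$; $(L\lor)$ $F_0,F_0\lor F_1,\Gamma\Rightarrow\Delta$ and $F_1,F_0\lor F_1,\Gamma\Rightarrow\Delta$ / $F_0\lor F_1,\Gamma\Rightarrow\Delta$; $(R\lor)$ $\Gamma\Rightarrow\Delta,F_0\lor F_1,F_i$ / $\Gamma\Rightarrow\Delta,F_0\lor F_1$ ($i\in\{0,1\}$); $(L\land)$ $F_i,F_0\land F_1,\Gamma\Rightarrow\Delta$ / $F_0\land F_1,\Gamma\Rightarrow\Delta$; $(R\land)$ $\Gamma\Rightarrow\Delta,F_0\land F_1,F_0$ and $\Gamma\Rightarrow\Delta,F_0\land F_1,F_1$ / $\Gamma\Rightarrow\Delta,F_0\land F_1$; $(L\exists^0)$ $F(a),\exists xF(x),\Gamma\Rightarrow\Delta$ / $\exists xF(x),\Gamma\Rightarrow\Delta$; $(R\exists^0)$ $\Gamma\Rightarrow\Delta,\exists xF(x),F(t)$ / $\Gamma\Rightarrow\Delta,\exists xF(x)$; $(L\forall^0)$ $F(t),\forall xF(x),\Gamma\Rightarrow\Delta$ / $\forall xF(x),\Gamma\Rightarrow\Delta$; $(R\forall^0)$ $\Gamma\Rightarrow\Delta,\forall xF(x),F(a)$ / $\Gamma\Rightarrow\Delta,\forall xF(x)$; the second-order rules $(L\exists^1),(R\exists^1),(L\forall^1),(R\forall^1)$ are the same with $\exists X^n,\forall X^n$, an arbitrary abstract $T\in Tm_1^{(n)}$ in place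 of $t$ in $(R\exists^1),(L\forall^1)$ and an eigenvariable $Y$ in $(L\exists^1),(R\forall^1)$; eigenvariables $a,Y$ must not occur in the conclusion; and $(cut)$: $\Gamma\Rightarrow\Delta,C$ and $C,\Pi\Rightarrow\Theta$ / $\Gamma,\Pi\Rightarrow\Delta,\Theta$. There are no explicit structural rules. $\supset$ abbreviates $\lnot A\lor B$. For a complete Boolean algebra $\mathbb{B}$ with complement $-a$: ${\tt D}\mathbb{B}=\{(a,b)\in\mathbb{B}\times\mathbb{B}:a\leq b\}$; write ${\tt a}=(\Box{\tt a},\Diamond{\tt a})$. Define $-{\tt a}=(-\Diamond{\tt a},-\Box{\tt a})$; ${\tt a}\unlhd{\tt b}$ iff $\Box{\tt a}\leq\Box{\tt b}$ and $\Diamond{\tt a}\geq\Diamond{\tt b}$; $\sup_<\{{\tt a}_\lambda\}=(\sup\Box{\tt a}_\lambda,\sup\Diamond{\tt a}_\lambda)$, $\inf_<\{{\tt a}_\lambda\}=(\inf\Box{\tt a}_\lambda,\inf\Diamond{\tt a}_\lambda)$. A semi ${\tt D}\mathbb{B}$-valuation is a map $V$ from the set of all formulas to ${\tt D}\mathbb{B}$ such that: $V(\lnot F)\unlhd -V(F)$; $V(F_0\lor F_1)\unlhd\sup_<\{V(F_0),V(F_1)\}$; $V(F_0\land F_1)\unlhd\inf_<\{V(F_0),V(F_1)\}$; $V(\exists xF(x))\unlhd\sup_<\{V(F(t)):t\in Tm_0\}$; $V(\forall xF(x))\unlhd\inf_<\{V(F(t)):t\in Tm_0\}$; $V(\exists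 X^nF(X))\unlhd\sup_<\{V(F(T)):T\in Tm_1^{(n)}\}$; $V(\forall X^nF(X))\unlhd\inf_<\{V(F(T)):T\in Tm_1^{(n)}\}$. -}

module Defs where

open import Data.Nat using (ℕ; zero; suc)
open import Data.Fin using (Fin; zero; suc)
open import Data.Vec using (Vec; lookup)
open import Data.Vec.Relation.Unary.Any using () renaming (Any to VAny)
open import Data.List using (List; []; _∷_; _++_)
open import Data.List.Membership.Propositional using (_∈_)
open import Data.List.Relation.Binary.Subset.Propositional using (_⊆_)
open import Data.List.Relation.Unary.Any using (here; there)
open import Data.List.Relation.Unary.All using (All)
open import Data.Product using (Σ; _×_; _,_; proj₁)
open import Data.Sum using (_⊎_)
open import Data.Empty using (⊥)
import Data.Unit
import Data.Bool
import Data.Vec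
open import Relation.Nullary using (¬_)
open import Relation.Binary.PropositionalEquality using (_≡_; refl)
open import Relation.Binary.Structures using (IsPartialOrder)

-- Syntax (locally nameless, intrinsically scoped)
--
-- Bound first-order
-- variables are de Bruijn indices (Fin m, m = number of enclosing
-- first-order binders).  A second-order variable of arity (suc k)
-- (arities are ≥ 1) is either free, named by ℕ (variables of distinct
-- arities are distinct), or bound, given by a position in the list Σ
-- of arities of the enclosing second-order binders.

data Term (m : ℕ) : Set where
  fv : ℕ → Term m
  bv : Fin m → Term m

infixr 6 _∨'_
infixr 7 _∧'_

data Formula (m : ℕ) (Σ' : List ℕ) : Set where
  fatom : (k : ℕ) → (x : ℕ) → Vec (Term m) (suc k) → Formula m Σ'
  batom : {k : ℕ} → k ∈ Σ' → Vec (Term m) (suc k) → Formula m Σ'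
  ¬'    : Formula m Σ' → Formula m Σ'
  _∨'_  : Formula m Σ' → Formula m Σ' → Formula m Σ'
  _∧'_  : Formula m Σ' → Formula m Σ' → Formula m Σ'
  ∃⁰    : Formula (suc m) Σ' → Formula m Σ'
  ∀⁰    : Formula (suc m) Σ' → Formula m Σ'
  ∃¹    : (k : ℕ) → Formula m (k ∷ Σ') → Formula m Σ'
  ∀¹    : (k : ℕ) → Formula m (k ∷ Σ') → Formula m Σ'

Fm : Set
Fm = Formula 0 []

-- First-order terms Tm₀: the (free) first-order variables.
Tm₀ : Set
Tm₀ = ℕ

-- (suc k)-ary abstracts λx₁…x_{suc k}.G : G with the x's as the
-- (suc k) dangling bound first-order variables (x_i ↦ index i).
Abs : ℕ → Set
Abs k = Formula (suc k) []

allBv : (n : ℕ) → Vec (Term n) n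
allBv n = Data.Vec.tabulate bv

varAbs : (k : ℕ) → ℕ → Abs k
varAbs k y = fatom k y (allBv (suc k))

isAtomic : Fm → Set
isAtomic (fatom _ _ _) = Data.Unit.⊤
isAtomic _ = ⊥

wkT : {m : ℕ} → Term m → Term (suc m)
wkT (fv a) = fv a
wkT (bv i) = bv (suc i)

liftS : {m m' : ℕ} → (Fin m → Term m') → Fin (suc m) → Term (suc m')
liftS σ zero    = bv zero
liftS σ (suc i) = wkT (σ i)

substT : {m m' : ℕ} → (Fin m → Term m') → Term m → Term m'
substT σ (fv a) = fv a
substT σ (bv i) = σ i

subst⁰ : {m m' : ℕ} {Σ' : List ℕ} → (Fin m → Term m') → Formula m Σ' → Formula m' Σ'
subst⁰ σ (fatom k x ts) = fatom k x (Data.Vec.map (substT σ) ts)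
subst⁰ σ (batom p ts)   = batom p (Data.Vec.map (substT σ) ts)
subst⁰ σ (¬' F)         = ¬' (subst⁰ σ F)
subst⁰ σ (F ∨' G)       = subst⁰ σ F ∨' subst⁰ σ G
subst⁰ σ (F ∧' G)       = subst⁰ σ F ∧' subst⁰ σ G
subst⁰ σ (∃⁰ F)         = ∃⁰ (subst⁰ (liftS σ) F)
subst⁰ σ (∀⁰ F)         = ∀⁰ (subst⁰ (liftS σ) F)
subst⁰ σ (∃¹ k F)       = ∃¹ k (subst⁰ σ F)
subst⁰ σ (∀¹ k F)       = ∀¹ k (subst⁰ σ F)

Ren¹ : List ℕ → List ℕ → Set
Ren¹ Σ₁ Σ₂ = {k : ℕ} → k ∈ Σ₁ → k ∈ Σ₂

liftR¹ : {Σ₁ Σ₂ : List ℕ} {j : ℕ} → Ren¹ Σ₁ Σ₂ → Ren¹ (j ∷ Σ₁) (j ∷ Σ₂)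
liftR¹ ρ (here eq) = here eq
liftR¹ ρ (there p) = there (ρ p)

ren¹ : {m : ℕ} {Σ₁ Σ₂ : List ℕ} → Ren¹ Σ₁ Σ₂ → Formula m Σ₁ → Formula m Σ₂
ren¹ ρ (fatom k x ts) = fatom k x ts
ren¹ ρ (batom p ts)   = batom (ρ p) ts
ren¹ ρ (¬' F)         = ¬' (ren¹ ρ F)
ren¹ ρ (F ∨' G)       = ren¹ ρ F ∨' ren¹ ρ G
ren¹ ρ (F ∧' G)       = ren¹ ρ F ∧' ren¹ ρ G
ren¹ ρ (∃⁰ F)         = ∃⁰ (ren¹ ρ F)
ren¹ ρ (∀⁰ F)         = ∀⁰ (ren¹ ρ F)
ren¹ ρ (∃¹ k F)       = ∃¹ k (ren¹ (liftR¹ ρ) F)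
ren¹ ρ (∀¹ k F)       = ∀¹ k (ren¹ (liftR¹ ρ) F)

data SOVal (Σ₂ : List ℕ) (k : ℕ) : Set where
  var : k ∈ Σ₂ → SOVal Σ₂ k
  abs : Abs k → SOVal Σ₂ k

Sub¹ : List ℕ → List ℕ → Set
Sub¹ Σ₁ Σ₂ = {k : ℕ} → k ∈ Σ₁ → SOVal Σ₂ k

liftSub¹ : {Σ₁ Σ₂ : List ℕ} {j : ℕ} → Sub¹ Σ₁ Σ₂ → Sub¹ (j ∷ Σ₁) (j ∷ Σ₂)
liftSub¹ σ (here eq) = var (here eq)
liftSub¹ σ (there p) with σ p
... | var q = var (there q)
... | abs G = abs G

noBound : {Σ₂ : List ℕ} → Ren¹ [] Σ₂
noBound ()

sub¹ : {m : ℕ} {Σ₁ Σ₂ : List ℕ} → Sub¹ Σ₁ Σ₂ → Formula m Σ₁ → Formula m Σ₂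
sub¹ σ (fatom k x ts) = fatom k x ts
sub¹ σ (batom p ts) with σ p
... | var q = batom q ts
... | abs G = ren¹ noBound (subst⁰ (lookup ts) G)
sub¹ σ (¬' F)         = ¬' (sub¹ σ F)
sub¹ σ (F ∨' G)       = sub¹ σ F ∨' sub¹ σ G
sub¹ σ (F ∧' G)       = sub¹ σ F ∧' sub¹ σ G
sub¹ σ (∃⁰ F)         = ∃⁰ (sub¹ σ F)
sub¹ σ (∀⁰ F)         = ∀⁰ (sub¹ σ F)
sub¹ σ (∃¹ k F)       = ∃¹ k (sub¹ (liftSub¹ σ) F)
sub¹ σ (∀¹ k F)       = ∀¹ k (sub¹ (liftSub¹ σ) F)

inst⁰ : Formula 1 [] → Tm₀ → Fm
inst⁰ F a = subst⁰ (λ _ → fv a) F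

inst¹ : {k : ℕ} → Formula 0 (k ∷ []) → Abs k → Fm
inst¹ {k} F T = sub¹ σ F
  where
  σ : Sub¹ (k ∷ []) []
  σ (here refl) = abs T
  σ (there ())

occT : {m : ℕ} → ℕ → Term m → Set
occT a (fv b) = a ≡ b
occT a (bv _) = ⊥

occ⁰ : {m : ℕ} {Σ' : List ℕ} → ℕ → Formula m Σ' → Set
occ⁰ a (fatom k x ts) = VAny (occT a) ts
occ⁰ a (batom p ts)   = VAny (occT a) ts
occ⁰ a (¬' F)         = occ⁰ a F
occ⁰ a (F ∨' G)       = occ⁰ a F ⊎ occ⁰ a G
occ⁰ a (F ∧' G)       = occ⁰ a F ⊎ occ⁰ a G
occ⁰ a (∃⁰ F)         = occ⁰ a F
occ⁰ a (∀⁰ F)         = occ⁰ a F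
occ⁰ a (∃¹ k F)       = occ⁰ a F
occ⁰ a (∀¹ k F)       = occ⁰ a F

occ¹ : {m : ℕ} {Σ' : List ℕ} → ℕ → ℕ → Formula m Σ' → Set
occ¹ j y (fatom k x ts) = (j ≡ k) × (y ≡ x)
occ¹ j y (batom p ts)   = ⊥
occ¹ j y (¬' F)         = occ¹ j y F
occ¹ j y (F ∨' G)       = occ¹ j y F ⊎ occ¹ j y G
occ¹ j y (F ∧' G)       = occ¹ j y F ⊎ occ¹ j y G
occ¹ j y (∃⁰ F)         = occ¹ j y F
occ¹ j y (∀⁰ F)         = occ¹ j y F
occ¹ j y (∃¹ k F)       = occ¹ j y F
occ¹ j y (∀¹ k F)       = occ¹ j y F

fresh⁰ : ℕ → List Fm → List Fm → Set
fresh⁰ a Γ Δ = All (λ F → ¬ occ⁰ a F) Γ × All (λ F → ¬ occ⁰ a F) Δ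

fresh¹ : ℕ → ℕ → List Fm → List Fm → Set
fresh¹ k y Γ Δ = All (λ F → ¬ occ¹ k y F) Γ × All (λ F → ¬ occ¹ k y F) Δ

-- Sequents are pairs of finite sets, represented by
-- lists read up to set equality.  A rule with conclusion
-- "F, Γ' ⇒ Δ" and premise "F, Γ' ⇒ Δ, G" is rendered as: F ∈ Γ and
-- Γ ⇒ G ∷ Δ gives Γ ⇒ Δ (the conclusion's antecedent Γ = {F} ∪ Γ').

_≋_ : List Fm → List Fm → Set
Γ ≋ Γ' = (Γ ⊆ Γ') × (Γ' ⊆ Γ)

infix 4 _⊢_

data _⊢_ : List Fm → List Fm → Set where
  init : {Γ Δ : List Fm} (A : Fm) → isAtomic A → A ∈ Γ → A ∈ Δ → Γ ⊢ Δ
  L¬   : {Γ Δ : List Fm} {F : Fm} → ¬' F ∈ Γ → Γ ⊢ F ∷ Δ → Γ ⊢ Δ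
  R¬   : {Γ Δ : List Fm} {F : Fm} → ¬' F ∈ Δ → F ∷ Γ ⊢ Δ → Γ ⊢ Δ
  L∨   : {Γ Δ : List Fm} {F₀ F₁ : Fm} → (F₀ ∨' F₁) ∈ Γ →
         F₀ ∷ Γ ⊢ Δ → F₁ ∷ Γ ⊢ Δ → Γ ⊢ Δ
  R∨₀  : {Γ Δ : List Fm} {F₀ F₁ : Fm} → (F₀ ∨' F₁) ∈ Δ → Γ ⊢ F₀ ∷ Δ → Γ ⊢ Δ
  R∨₁  : {Γ Δ : List Fm} {F₀ F₁ : Fm} → (F₀ ∨' F₁) ∈ Δ → Γ ⊢ F₁ ∷ Δ → Γ ⊢ Δ
  L∧₀  : {Γ Δ : List Fm} {F₀ F₁ : Fm} → (F₀ ∧' F₁) ∈ Γ → F₀ ∷ Γ ⊢ Δ → Γ ⊢ Δ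
  L∧₁  : {Γ Δ : List Fm} {F₀ F₁ : Fm} → (F₀ ∧' F₁) ∈ Γ → F₁ ∷ Γ ⊢ Δ → Γ ⊢ Δ
  R∧   : {Γ Δ : List Fm} {F₀ F₁ : Fm} → (F₀ ∧' F₁) ∈ Δ →
         Γ ⊢ F₀ ∷ Δ → Γ ⊢ F₁ ∷ Δ → Γ ⊢ Δ
  L∃⁰  : {Γ Δ : List Fm} {F : Formula 1 []} → ∃⁰ F ∈ Γ → (a : ℕ) →
         fresh⁰ a Γ Δ → inst⁰ F a ∷ Γ ⊢ Δ → Γ ⊢ Δ
  R∃⁰  : {Γ Δ : List Fm} {F : Formula 1 []} → ∃⁰ F ∈ Δ → (t : Tm₀) →
         Γ ⊢ inst⁰ F t ∷ Δ → Γ ⊢ Δ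
  L∀⁰  : {Γ Δ : List Fm} {F : Formula 1 []} → ∀⁰ F ∈ Γ → (t : Tm₀) →
         inst⁰ F t ∷ Γ ⊢ Δ → Γ ⊢ Δ
  R∀⁰  : {Γ Δ : List Fm} {F : Formula 1 []} → ∀⁰ F ∈ Δ → (a : ℕ) →
         fresh⁰ a Γ Δ → Γ ⊢ inst⁰ F a ∷ Δ → Γ ⊢ Δ
  L∃¹  : {Γ Δ : List Fm} {k : ℕ} {F : Formula 0 (k ∷ [])} → ∃¹ k F ∈ Γ →
         (y : ℕ) → fresh¹ k y Γ Δ → inst¹ F (varAbs k y) ∷ Γ ⊢ Δ → Γ ⊢ Δ
  R∃¹  : {Γ Δ : List Fm} {k : ℕ} {F : Formula 0 (k ∷ [])} → ∃¹ k F ∈ Δ →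
         (T : Abs k) → Γ ⊢ inst¹ F T ∷ Δ → Γ ⊢ Δ
  L∀¹  : {Γ Δ : List Fm} {k : ℕ} {F : Formula 0 (k ∷ [])} → ∀¹ k F ∈ Γ →
         (T : Abs k) → inst¹ F T ∷ Γ ⊢ Δ → Γ ⊢ Δ
  R∀¹  : {Γ Δ : List Fm} {k : ℕ} {F : Formula 0 (k ∷ [])} → ∀¹ k F ∈ Δ →
         (y : ℕ) → fresh¹ k y Γ Δ → Γ ⊢ inst¹ F (varAbs k y) ∷ Δ → Γ ⊢ Δ
  cut  : {Γ Δ Γ₁ Δ₁ Γ₂ Δ₂ : List Fm} (C : Fm) →
         Γ₁ ⊢ C ∷ Δ₁ → C ∷ Γ₂ ⊢ Δ₂ →
         Γ ≋ (Γ₁ ++ Γ₂) → Δ ≋ (Δ₁ ++ Δ₂) → Γ ⊢ Δ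

record CompleteBooleanAlgebra : Set₁ where
  infix 4 _≈_ _≤_
  infixr 6 _⊔_
  infixr 7 _⊓_
  field
    Carrier        : Set
    _≈_            : Carrier → Carrier → Set
    _≤_            : Carrier → Carrier → Set
    isPartialOrder : IsPartialOrder _≈_ _≤_
    ⊤ ⊥'           : Carrier
    _⊓_ _⊔_        : Carrier → Carrier → Carrier
    -_             : Carrier → Carrier
    ⋁ ⋀            : {I : Set} → (I → Carrier) → Carrier
    ⊤-max          : ∀ x → x ≤ ⊤
    ⊥-min          : ∀ x → ⊥' ≤ x
    ⊓-lb₁          : ∀ x y → x ⊓ y ≤ x
    ⊓-lb₂          : ∀ x y → x ⊓ y ≤ y
    ⊓-glb          : ∀ x y z → z ≤ x → z ≤ y → z ≤ x ⊓ y
    ⊔-ub₁          : ∀ x y → x ≤ x ⊔ y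
    ⊔-ub₂          : ∀ x y → y ≤ x ⊔ y
    ⊔-lub          : ∀ x y z → x ≤ z → y ≤ z → x ⊔ y ≤ z
    distrib        : ∀ x y z → x ⊓ (y ⊔ z) ≤ (x ⊓ y) ⊔ (x ⊓ z)
    compl-⊓        : ∀ x → x ⊓ (- x) ≈ ⊥'
    compl-⊔        : ∀ x → x ⊔ (- x) ≈ ⊤
    ⋁-ub           : {I : Set} (f : I → Carrier) (i : I) → f i ≤ ⋁ f
    ⋁-lub          : {I : Set} (f : I → Carrier) (z : Carrier) →
                     (∀ i → f i ≤ z) → ⋁ f ≤ z
    ⋀-lb           : {I : Set} (f : I → Carrier) (i : I) → ⋀ f ≤ f i
    ⋀-glb          : {I : Set} (f : I → Carrier) (z : Carrier) →
                     (∀ i → z ≤ f i) → z ≤ ⋀ f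

module _ (B : CompleteBooleanAlgebra) where
  open CompleteBooleanAlgebra B

  record D : Set where
    constructor mkD
    field
      □ ◇  : Carrier
      □≤◇  : □ ≤ ◇
  open D public

  Pair : Set
  Pair = Carrier × Carrier

  ∣_∣ : D → Pair
  ∣ a ∣ = □ a , ◇ a

  _⊴_ : Pair → Pair → Set
  (a₁ , a₂) ⊴ (b₁ , b₂) = (a₁ ≤ b₁) × (b₂ ≤ a₂)

  negD : D → Pair
  negD a = - ◇ a , - □ a

  sup< : {I : Set} → (I → D) → Pair
  sup< f = ⋁ (λ i → □ (f i)) , ⋁ (λ i → ◇ (f i))

  inf< : {I : Set} → (I → D) → Pair
  inf< f = ⋀ (λ i → □ (f i)) , ⋀ (λ i → ◇ (f i))

  two : D → D → Data.Bool.Bool → D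
  two a b Data.Bool.false = a
  two a b Data.Bool.true  = b

  record SemiValuation : Set where
    field
      V    : Fm → D
      V¬   : ∀ F → ∣ V (¬' F) ∣ ⊴ negD (V F)
      V∨   : ∀ F₀ F₁ → ∣ V (F₀ ∨' F₁) ∣ ⊴ sup< (two (V F₀) (V F₁))
      V∧   : ∀ F₀ F₁ → ∣ V (F₀ ∧' F₁) ∣ ⊴ inf< (two (V F₀) (V F₁))
      V∃⁰  : ∀ F → ∣ V (∃⁰ F) ∣ ⊴ sup< (λ (t : Tm₀) → V (inst⁰ F t))
      V∀⁰  : ∀ F → ∣ V (∀⁰ F) ∣ ⊴ inf< (λ (t : Tm₀) → V (inst⁰ F t))
      V∃¹  : ∀ k F → ∣ V (∃¹ k F) ∣ ⊴ sup< (λ (T : Abs k) → V (inst¹ F T))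
      V∀¹  : ∀ k F → ∣ V (∀¹ k F) ∣ ⊴ inf< (λ (T : Abs k) → V (inst¹ F T))

-- Interpret formulas in 𝔹 over the first-order domain ℕ of variable names, letting
-- second-order variables range over candidates: an abstract T together with a predicate P
-- such that □V(T(v)) ≤ P(v) ≤ ◇V(T(v)) for all v.  The inequalities of a semi-valuation are
-- exactly what is needed to propagate the squeeze □V(A) ≤ ⟦F⟧ ≤ ◇V(A), where A is the closed
-- instance of F named by the environment; for ∃¹/∀¹ the bound on one side uses the candidate
-- (T, □V(T(-))), which exists because □ ≤ ◇.  By the same squeeze every abstract T denotes
-- the candidate (T, ⟦T⟧), so the model satisfies comprehension and, being an honest
-- Boolean-valued model, validates every rule of G¹LC including cut.  At the identity
-- environment this gives inf □V(Γ) ≤ inf ⟦Γ⟧ ≤ sup ⟦Δ⟧ ≤ sup ◇V(Δ).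

module Submission where

open import Defs
open import Data.Bool using (false; true)
open import Data.Empty using (⊥-elim)
open import Data.Fin using (Fin; zero; suc)
open import Data.List using (List; []; _∷_)
open import Data.List.Membership.Propositional using (_∈_)
open import Data.List.Relation.Unary.Any using (here; there)
open import Data.List.Relation.Unary.All using (All) renaming (lookup to All-lookup)
open import Data.List.Relation.Binary.Subset.Propositional using (_⊆_)
open import Data.List.Membership.Propositional.Properties using (∈-++⁺ˡ; ∈-++⁺ʳ)
open import Data.Nat using (ℕ; suc; _≟_)
open import Data.Product using (Σ; _×_; _,_; proj₁; proj₂)
open import Data.Sum using (inj₁; inj₂)
open import Data.Vec using (Vec; []; _∷_; lookup; map)
import Data.Vec.Relation.Unary.Any as VAny
open import Data.Vec.Functional using () renaming ([] to []ᶠ; _∷_ to _∷ᶠ_)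
open import Data.Vec.Properties
  using (map-cong; map-∘; map-id; lookup-map; tabulate-∘; tabulate-cong; tabulate∘lookup)
open import Function using (_∘_; id)
open import Relation.Nullary using (¬_; yes; no)
open import Relation.Binary.PropositionalEquality
  using (_≡_; _≗_; refl; sym; trans; cong; cong₂; subst)
open import Relation.Binary.Structures using (IsPartialOrder)

private
  variable
    m m' m'' n : ℕ
    Σ₀ Σ₁ Σ₂ : List ℕ

map-fusion : {A B C : Set} {f : B → C} {g : A → B} {h : A → C} →
  (∀ x → f (g x) ≡ h x) → (xs : Vec A n) → map f (map g xs) ≡ map h xs
map-fusion fg≗h xs = trans (sym (map-∘ _ _ xs)) (map-cong fg≗h xs)

map-allBv : {A : Set} (f : Term n → A) (xs : Vec A n) →
  (∀ i → f (bv i) ≡ lookup xs i) → map f (allBv n) ≡ xs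
map-allBv f xs f∘bv≗xs =
  trans (sym (tabulate-∘ f bv)) (trans (tabulate-cong f∘bv≗xs) (tabulate∘lookup xs))

_≗ˢ_ : Sub¹ Σ₁ Σ₂ → Sub¹ Σ₁ Σ₂ → Set
τ ≗ˢ τ' = ∀ {k} (p : k ∈ _) → τ p ≡ τ' p

_≗ʳ_ : Ren¹ Σ₁ Σ₂ → Ren¹ Σ₁ Σ₂ → Set
r ≗ʳ r' = ∀ {k} (p : k ∈ _) → r p ≡ r' p

liftS-cong : {σ σ' : Fin m → Term m'} → σ ≗ σ' → liftS σ ≗ liftS σ'
liftS-cong σ≗σ' zero    = refl
liftS-cong σ≗σ' (suc i) = cong wkT (σ≗σ' i)

substT-cong : {σ σ' : Fin m → Term m'} → σ ≗ σ' → substT σ ≗ substT σ'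
substT-cong σ≗σ' (fv a) = refl
substT-cong σ≗σ' (bv i) = σ≗σ' i

subst⁰-cong : {σ σ' : Fin m → Term m'} → σ ≗ σ' → (F : Formula m Σ₀) → subst⁰ σ F ≡ subst⁰ σ' F
subst⁰-cong σ≗σ' (fatom k x ts) = cong (fatom k x) (map-cong (substT-cong σ≗σ') ts)
subst⁰-cong σ≗σ' (batom p ts)   = cong (batom p) (map-cong (substT-cong σ≗σ') ts)
subst⁰-cong σ≗σ' (¬' F)         = cong ¬' (subst⁰-cong σ≗σ' F)
subst⁰-cong σ≗σ' (F ∨' G)       = cong₂ _∨'_ (subst⁰-cong σ≗σ' F) (subst⁰-cong σ≗σ' G)
subst⁰-cong σ≗σ' (F ∧' G)       = cong₂ _∧'_ (subst⁰-cong σ≗σ' F) (subst⁰-cong σ≗σ' G)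
subst⁰-cong σ≗σ' (∃⁰ F)         = cong ∃⁰ (subst⁰-cong (liftS-cong σ≗σ') F)
subst⁰-cong σ≗σ' (∀⁰ F)         = cong ∀⁰ (subst⁰-cong (liftS-cong σ≗σ') F)
subst⁰-cong σ≗σ' (∃¹ k F)       = cong (∃¹ k) (subst⁰-cong σ≗σ' F)
subst⁰-cong σ≗σ' (∀¹ k F)       = cong (∀¹ k) (subst⁰-cong σ≗σ' F)

liftS-∘ : (σ' : Fin m' → Term m'') (σ : Fin m → Term m') →
  substT (liftS σ') ∘ liftS σ ≗ liftS (substT σ' ∘ σ)
liftS-∘ σ' σ zero = refl
liftS-∘ σ' σ (suc i) with σ i
... | fv a = refl
... | bv j = refl

substT-∘ : (σ' : Fin m' → Term m'') (σ : Fin m → Term m') →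
  substT σ' ∘ substT σ ≗ substT (substT σ' ∘ σ)
substT-∘ σ' σ (fv a) = refl
substT-∘ σ' σ (bv i) = refl

subst⁰-∘ : (σ' : Fin m' → Term m'') (σ : Fin m → Term m') (F : Formula m Σ₀) →
  subst⁰ σ' (subst⁰ σ F) ≡ subst⁰ (substT σ' ∘ σ) F
subst⁰-∘ σ' σ (fatom k x ts) = cong (fatom k x) (map-fusion (substT-∘ σ' σ) ts)
subst⁰-∘ σ' σ (batom p ts)   = cong (batom p) (map-fusion (substT-∘ σ' σ) ts)
subst⁰-∘ σ' σ (¬' F)         = cong ¬' (subst⁰-∘ σ' σ F)
subst⁰-∘ σ' σ (F ∨' G)       = cong₂ _∨'_ (subst⁰-∘ σ' σ F) (subst⁰-∘ σ' σ G)
subst⁰-∘ σ' σ (F ∧' G)       = cong₂ _∧'_ (subst⁰-∘ σ' σ F) (subst⁰-∘ σ' σ G)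
subst⁰-∘ σ' σ (∃⁰ F)         =
  cong ∃⁰ (trans (subst⁰-∘ (liftS σ') (liftS σ) F) (subst⁰-cong (liftS-∘ σ' σ) F))
subst⁰-∘ σ' σ (∀⁰ F)         =
  cong ∀⁰ (trans (subst⁰-∘ (liftS σ') (liftS σ) F) (subst⁰-cong (liftS-∘ σ' σ) F))
subst⁰-∘ σ' σ (∃¹ k F)       = cong (∃¹ k) (subst⁰-∘ σ' σ F)
subst⁰-∘ σ' σ (∀¹ k F)       = cong (∀¹ k) (subst⁰-∘ σ' σ F)

liftR¹-id : {j : ℕ} {r : Ren¹ Σ₀ Σ₀} → r ≗ʳ id → liftR¹ {j = j} r ≗ʳ id
liftR¹-id r≗id (here eq) = refl
liftR¹-id r≗id (there p) = cong there (r≗id p)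

ren¹-id : {r : Ren¹ Σ₀ Σ₀} → r ≗ʳ id → (F : Formula m Σ₀) → ren¹ r F ≡ F
ren¹-id r≗id (fatom k x ts) = refl
ren¹-id r≗id (batom p ts)   = cong (λ q → batom q ts) (r≗id p)
ren¹-id r≗id (¬' F)         = cong ¬' (ren¹-id r≗id F)
ren¹-id r≗id (F ∨' G)       = cong₂ _∨'_ (ren¹-id r≗id F) (ren¹-id r≗id G)
ren¹-id r≗id (F ∧' G)       = cong₂ _∧'_ (ren¹-id r≗id F) (ren¹-id r≗id G)
ren¹-id r≗id (∃⁰ F)         = cong ∃⁰ (ren¹-id r≗id F)
ren¹-id r≗id (∀⁰ F)         = cong ∀⁰ (ren¹-id r≗id F)
ren¹-id r≗id (∃¹ k F)       = cong (∃¹ k) (ren¹-id (liftR¹-id r≗id) F)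
ren¹-id r≗id (∀¹ k F)       = cong (∀¹ k) (ren¹-id (liftR¹-id r≗id) F)

subst⁰-ren¹ : (σ : Fin m → Term m') (r : Ren¹ Σ₁ Σ₂) (F : Formula m Σ₁) →
  subst⁰ σ (ren¹ r F) ≡ ren¹ r (subst⁰ σ F)
subst⁰-ren¹ σ r (fatom k x ts) = refl
subst⁰-ren¹ σ r (batom p ts)   = refl
subst⁰-ren¹ σ r (¬' F)         = cong ¬' (subst⁰-ren¹ σ r F)
subst⁰-ren¹ σ r (F ∨' G)       = cong₂ _∨'_ (subst⁰-ren¹ σ r F) (subst⁰-ren¹ σ r G)
subst⁰-ren¹ σ r (F ∧' G)       = cong₂ _∧'_ (subst⁰-ren¹ σ r F) (subst⁰-ren¹ σ r G)
subst⁰-ren¹ σ r (∃⁰ F)         = cong ∃⁰ (subst⁰-ren¹ (liftS σ) r F)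
subst⁰-ren¹ σ r (∀⁰ F)         = cong ∀⁰ (subst⁰-ren¹ (liftS σ) r F)
subst⁰-ren¹ σ r (∃¹ k F)       = cong (∃¹ k) (subst⁰-ren¹ σ (liftR¹ r) F)
subst⁰-ren¹ σ r (∀¹ k F)       = cong (∀¹ k) (subst⁰-ren¹ σ (liftR¹ r) F)

liftSub¹-liftR¹ : {j : ℕ} (τ : Sub¹ Σ₁ Σ₂) (r : Ren¹ Σ₀ Σ₁) (r' : Ren¹ Σ₀ Σ₂) →
  (∀ {k} (p : k ∈ Σ₀) → τ (r p) ≡ var (r' p)) →
  ∀ {k} (p : k ∈ j ∷ Σ₀) → liftSub¹ τ (liftR¹ r p) ≡ var (liftR¹ r' p)
liftSub¹-liftR¹ τ r r' τ∘r≡r' (here eq) = refl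
liftSub¹-liftR¹ τ r r' τ∘r≡r' (there p) rewrite τ∘r≡r' p = refl

sub¹-ren¹ : (τ : Sub¹ Σ₁ Σ₂) (r : Ren¹ Σ₀ Σ₁) (r' : Ren¹ Σ₀ Σ₂) →
  (∀ {k} (p : k ∈ Σ₀) → τ (r p) ≡ var (r' p)) →
  (F : Formula m Σ₀) → sub¹ τ (ren¹ r F) ≡ ren¹ r' F
sub¹-ren¹ τ r r' h (fatom k x ts) = refl
sub¹-ren¹ τ r r' h (batom p ts) rewrite h p = refl
sub¹-ren¹ τ r r' h (¬' F)         = cong ¬' (sub¹-ren¹ τ r r' h F)
sub¹-ren¹ τ r r' h (F ∨' G)       = cong₂ _∨'_ (sub¹-ren¹ τ r r' h F) (sub¹-ren¹ τ r r' h G)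
sub¹-ren¹ τ r r' h (F ∧' G)       = cong₂ _∧'_ (sub¹-ren¹ τ r r' h F) (sub¹-ren¹ τ r r' h G)
sub¹-ren¹ τ r r' h (∃⁰ F)         = cong ∃⁰ (sub¹-ren¹ τ r r' h F)
sub¹-ren¹ τ r r' h (∀⁰ F)         = cong ∀⁰ (sub¹-ren¹ τ r r' h F)
sub¹-ren¹ τ r r' h (∃¹ k F)       =
  cong (∃¹ k) (sub¹-ren¹ (liftSub¹ τ) (liftR¹ r) (liftR¹ r') (liftSub¹-liftR¹ τ r r' h) F)
sub¹-ren¹ τ r r' h (∀¹ k F)       =
  cong (∀¹ k) (sub¹-ren¹ (liftSub¹ τ) (liftR¹ r) (liftR¹ r') (liftSub¹-liftR¹ τ r r' h) F)

substAllT : (Fin m → Term m') → (ℕ → ℕ) → Term m → Term m'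
substAllT σ ρ (fv a) = fv (ρ a)
substAllT σ ρ (bv i) = σ i

apply : {k : ℕ} → SOVal Σ₂ k → Vec (Term m) (suc k) → Formula m Σ₂
apply (var q) ts = batom q ts
apply (abs G) ts = ren¹ noBound (subst⁰ (lookup ts) G)

SOAssignment : Set
SOAssignment = (k x : ℕ) → Abs k

substAll : (Fin m → Term m') → Sub¹ Σ₁ Σ₂ → (ℕ → ℕ) → SOAssignment →
  Formula m Σ₁ → Formula m' Σ₂
substAll σ τ ρ χ (fatom k x ts) = apply (abs (χ k x)) (map (substAllT σ ρ) ts)
substAll σ τ ρ χ (batom p ts)   = apply (τ p) (map (substAllT σ ρ) ts)
substAll σ τ ρ χ (¬' F)         = ¬' (substAll σ τ ρ χ F)
substAll σ τ ρ χ (F ∨' G)       = substAll σ τ ρ χ F ∨' substAll σ τ ρ χ G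
substAll σ τ ρ χ (F ∧' G)       = substAll σ τ ρ χ F ∧' substAll σ τ ρ χ G
substAll σ τ ρ χ (∃⁰ F)         = ∃⁰ (substAll (liftS σ) τ ρ χ F)
substAll σ τ ρ χ (∀⁰ F)         = ∀⁰ (substAll (liftS σ) τ ρ χ F)
substAll σ τ ρ χ (∃¹ k F)       = ∃¹ k (substAll σ (liftSub¹ τ) ρ χ F)
substAll σ τ ρ χ (∀¹ k F)       = ∀¹ k (substAll σ (liftSub¹ τ) ρ χ F)

substAllT-cong : {σ σ' : Fin m → Term m'} (ρ : ℕ → ℕ) → σ ≗ σ' → substAllT σ ρ ≗ substAllT σ' ρ
substAllT-cong ρ σ≗σ' (fv a) = refl
substAllT-cong ρ σ≗σ' (bv i) = σ≗σ' i

liftSub¹-cong : {j : ℕ} {τ τ' : Sub¹ Σ₁ Σ₂} → τ ≗ˢ τ' → liftSub¹ {j = j} τ ≗ˢ liftSub¹ τ'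
liftSub¹-cong τ≗τ' (here eq) = refl
liftSub¹-cong τ≗τ' (there p) rewrite τ≗τ' p = refl

substAll-cong : {σ σ' : Fin m → Term m'} {τ τ' : Sub¹ Σ₁ Σ₂} (ρ : ℕ → ℕ) (χ : SOAssignment) →
  σ ≗ σ' → τ ≗ˢ τ' → (F : Formula m Σ₁) → substAll σ τ ρ χ F ≡ substAll σ' τ' ρ χ F
substAll-cong ρ χ σ≗σ' τ≗τ' (fatom k x ts) =
  cong (apply (abs (χ k x))) (map-cong (substAllT-cong ρ σ≗σ') ts)
substAll-cong ρ χ σ≗σ' τ≗τ' (batom p ts)   =
  cong₂ apply (τ≗τ' p) (map-cong (substAllT-cong ρ σ≗σ') ts)
substAll-cong ρ χ σ≗σ' τ≗τ' (¬' F)         = cong ¬' (substAll-cong ρ χ σ≗σ' τ≗τ' F)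
substAll-cong ρ χ σ≗σ' τ≗τ' (F ∨' G)       =
  cong₂ _∨'_ (substAll-cong ρ χ σ≗σ' τ≗τ' F) (substAll-cong ρ χ σ≗σ' τ≗τ' G)
substAll-cong ρ χ σ≗σ' τ≗τ' (F ∧' G)       =
  cong₂ _∧'_ (substAll-cong ρ χ σ≗σ' τ≗τ' F) (substAll-cong ρ χ σ≗σ' τ≗τ' G)
substAll-cong ρ χ σ≗σ' τ≗τ' (∃⁰ F)         = cong ∃⁰ (substAll-cong ρ χ (liftS-cong σ≗σ') τ≗τ' F)
substAll-cong ρ χ σ≗σ' τ≗τ' (∀⁰ F)         = cong ∀⁰ (substAll-cong ρ χ (liftS-cong σ≗σ') τ≗τ' F)
substAll-cong ρ χ σ≗σ' τ≗τ' (∃¹ k F)       =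
  cong (∃¹ k) (substAll-cong ρ χ σ≗σ' (liftSub¹-cong τ≗τ') F)
substAll-cong ρ χ σ≗σ' τ≗τ' (∀¹ k F)       =
  cong (∀¹ k) (substAll-cong ρ χ σ≗σ' (liftSub¹-cong τ≗τ') F)

subst⁰-apply : {k : ℕ} (σ : Fin m → Term m') (v : SOVal Σ₂ k) (ts : Vec (Term m) (suc k)) →
  subst⁰ σ (apply v ts) ≡ apply v (map (substT σ) ts)
subst⁰-apply σ (var q) ts = refl
subst⁰-apply σ (abs G) ts = trans (subst⁰-ren¹ σ noBound (subst⁰ (lookup ts) G))
  (cong (ren¹ noBound) (trans (subst⁰-∘ σ (lookup ts) G)
    (subst⁰-cong (λ i → sym (lookup-map i (substT σ) ts)) G)))

substT-substAllT : (σ' : Fin m' → Term m'') (σ : Fin m → Term m') (ρ : ℕ → ℕ) →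
  substT σ' ∘ substAllT σ ρ ≗ substAllT (substT σ' ∘ σ) ρ
substT-substAllT σ' σ ρ (fv a) = refl
substT-substAllT σ' σ ρ (bv i) = refl

subst⁰-substAll : (σ' : Fin m' → Term m'') (σ : Fin m → Term m') (τ : Sub¹ Σ₁ Σ₂)
  (ρ : ℕ → ℕ) (χ : SOAssignment) (F : Formula m Σ₁) →
  subst⁰ σ' (substAll σ τ ρ χ F) ≡ substAll (substT σ' ∘ σ) τ ρ χ F
subst⁰-substAll σ' σ τ ρ χ (fatom k x ts) =
  trans (subst⁰-apply σ' (abs (χ k x)) (map (substAllT σ ρ) ts))
    (cong (apply (abs (χ k x))) (map-fusion (substT-substAllT σ' σ ρ) ts))
subst⁰-substAll σ' σ τ ρ χ (batom p ts)   =
  trans (subst⁰-apply σ' (τ p) (map (substAllT σ ρ) ts))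
    (cong (apply (τ p)) (map-fusion (substT-substAllT σ' σ ρ) ts))
subst⁰-substAll σ' σ τ ρ χ (¬' F)         = cong ¬' (subst⁰-substAll σ' σ τ ρ χ F)
subst⁰-substAll σ' σ τ ρ χ (F ∨' G)       =
  cong₂ _∨'_ (subst⁰-substAll σ' σ τ ρ χ F) (subst⁰-substAll σ' σ τ ρ χ G)
subst⁰-substAll σ' σ τ ρ χ (F ∧' G)       =
  cong₂ _∧'_ (subst⁰-substAll σ' σ τ ρ χ F) (subst⁰-substAll σ' σ τ ρ χ G)
subst⁰-substAll σ' σ τ ρ χ (∃⁰ F)         = cong ∃⁰ (trans (subst⁰-substAll (liftS σ') (liftS σ) τ ρ χ F)
  (substAll-cong ρ χ (liftS-∘ σ' σ) (λ p → refl) F))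
subst⁰-substAll σ' σ τ ρ χ (∀⁰ F)         = cong ∀⁰ (trans (subst⁰-substAll (liftS σ') (liftS σ) τ ρ χ F)
  (substAll-cong ρ χ (liftS-∘ σ' σ) (λ p → refl) F))
subst⁰-substAll σ' σ τ ρ χ (∃¹ k F)       = cong (∃¹ k) (subst⁰-substAll σ' σ (liftSub¹ τ) ρ χ F)
subst⁰-substAll σ' σ τ ρ χ (∀¹ k F)       = cong (∀¹ k) (subst⁰-substAll σ' σ (liftSub¹ τ) ρ χ F)

sub¹-SOVal : {k : ℕ} → Sub¹ Σ₁ Σ₂ → SOVal Σ₁ k → SOVal Σ₂ k
sub¹-SOVal τ (var q) = τ q
sub¹-SOVal τ (abs G) = abs G

sub¹-apply : {k : ℕ} (τ : Sub¹ Σ₁ Σ₂) (v : SOVal Σ₁ k) (ts : Vec (Term m) (suc k)) →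
  sub¹ τ (apply v ts) ≡ apply (sub¹-SOVal τ v) ts
sub¹-apply τ (var q) ts with τ q
... | var r = refl
... | abs G = refl
sub¹-apply τ (abs G) ts = sub¹-ren¹ τ noBound noBound (λ ()) (subst⁰ (lookup ts) G)

liftSub¹-∘ : {j : ℕ} (τ' : Sub¹ Σ₁ Σ₂) (τ : Sub¹ Σ₀ Σ₁) →
  (λ {k} (p : k ∈ j ∷ Σ₀) → sub¹-SOVal (liftSub¹ τ') (liftSub¹ τ p)) ≗ˢ
  liftSub¹ (sub¹-SOVal τ' ∘ τ)
liftSub¹-∘ τ' τ (here eq) = refl
liftSub¹-∘ τ' τ (there p) with τ p
... | abs G = refl
... | var q with τ' q
...   | var r = refl
...   | abs G = refl

sub¹-substAll : (τ' : Sub¹ Σ₁ Σ₂) (σ : Fin m → Term m') (τ : Sub¹ Σ₀ Σ₁)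
  (ρ : ℕ → ℕ) (χ : SOAssignment) (F : Formula m Σ₀) →
  sub¹ τ' (substAll σ τ ρ χ F) ≡ substAll σ (sub¹-SOVal τ' ∘ τ) ρ χ F
sub¹-substAll τ' σ τ ρ χ (fatom k x ts) = sub¹-apply τ' (abs (χ k x)) (map (substAllT σ ρ) ts)
sub¹-substAll τ' σ τ ρ χ (batom p ts)   = sub¹-apply τ' (τ p) (map (substAllT σ ρ) ts)
sub¹-substAll τ' σ τ ρ χ (¬' F)         = cong ¬' (sub¹-substAll τ' σ τ ρ χ F)
sub¹-substAll τ' σ τ ρ χ (F ∨' G)       =
  cong₂ _∨'_ (sub¹-substAll τ' σ τ ρ χ F) (sub¹-substAll τ' σ τ ρ χ G)
sub¹-substAll τ' σ τ ρ χ (F ∧' G)       =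
  cong₂ _∧'_ (sub¹-substAll τ' σ τ ρ χ F) (sub¹-substAll τ' σ τ ρ χ G)
sub¹-substAll τ' σ τ ρ χ (∃⁰ F)         = cong ∃⁰ (sub¹-substAll τ' (liftS σ) τ ρ χ F)
sub¹-substAll τ' σ τ ρ χ (∀⁰ F)         = cong ∀⁰ (sub¹-substAll τ' (liftS σ) τ ρ χ F)
sub¹-substAll τ' σ τ ρ χ (∃¹ k F)       =
  cong (∃¹ k) (trans (sub¹-substAll (liftSub¹ τ') σ (liftSub¹ τ) ρ χ F)
  (substAll-cong ρ χ (λ i → refl) (liftSub¹-∘ τ' τ) F))
sub¹-substAll τ' σ τ ρ χ (∀¹ k F)       =
  cong (∀¹ k) (trans (sub¹-substAll (liftSub¹ τ') σ (liftSub¹ τ) ρ χ F)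
  (substAll-cong ρ χ (λ i → refl) (liftSub¹-∘ τ' τ) F))

apply-varAbs : (k x : ℕ) (ts : Vec (Term m) (suc k)) → apply {Σ₂ = Σ₀} (abs (varAbs k x)) ts ≡ fatom k x ts
apply-varAbs k x ts = cong (fatom k x) (map-allBv (substT (lookup ts)) ts (λ i → refl))

liftS-bv : {σ : Fin m → Term m} → σ ≗ bv → liftS σ ≗ bv
liftS-bv σ≗bv zero    = refl
liftS-bv σ≗bv (suc i) = cong wkT (σ≗bv i)

liftSub¹-var : {j : ℕ} {τ : Sub¹ Σ₀ Σ₀} → τ ≗ˢ var → liftSub¹ {j = j} τ ≗ˢ var
liftSub¹-var τ≗var (here eq) = refl
liftSub¹-var τ≗var (there p) rewrite τ≗var p = refl

substAllT-id : {σ : Fin m → Term m} → σ ≗ bv → substAllT σ id ≗ id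
substAllT-id σ≗bv (fv a) = refl
substAllT-id σ≗bv (bv i) = σ≗bv i

substAll-id : {σ : Fin m → Term m} {τ : Sub¹ Σ₀ Σ₀} → σ ≗ bv → τ ≗ˢ var →
  (F : Formula m Σ₀) → substAll σ τ id varAbs F ≡ F
substAll-id {σ = σ} σ≗bv τ≗var (fatom k x ts) =
  trans (apply-varAbs k x (map (substAllT σ id) ts))
    (cong (fatom k x) (trans (map-cong (substAllT-id σ≗bv) ts) (map-id ts)))
substAll-id σ≗bv τ≗var (batom p ts)   =
  cong₂ apply (τ≗var p) (trans (map-cong (substAllT-id σ≗bv) ts) (map-id ts))
substAll-id σ≗bv τ≗var (¬' F)         = cong ¬' (substAll-id σ≗bv τ≗var F)
substAll-id σ≗bv τ≗var (F ∨' G)       = cong₂ _∨'_ (substAll-id σ≗bv τ≗var F) (substAll-id σ≗bv τ≗var G)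
substAll-id σ≗bv τ≗var (F ∧' G)       = cong₂ _∧'_ (substAll-id σ≗bv τ≗var F) (substAll-id σ≗bv τ≗var G)
substAll-id σ≗bv τ≗var (∃⁰ F)         = cong ∃⁰ (substAll-id (liftS-bv σ≗bv) τ≗var F)
substAll-id σ≗bv τ≗var (∀⁰ F)         = cong ∀⁰ (substAll-id (liftS-bv σ≗bv) τ≗var F)
substAll-id σ≗bv τ≗var (∃¹ k F)       = cong (∃¹ k) (substAll-id σ≗bv (liftSub¹-var τ≗var) F)
substAll-id σ≗bv τ≗var (∀¹ k F)       = cong (∀¹ k) (substAll-id σ≗bv (liftSub¹-var τ≗var) F)

module CompleteBooleanAlgebraProperties (B : CompleteBooleanAlgebra) where
  open CompleteBooleanAlgebra B public
  open IsPartialOrder isPartialOrder public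
    using (antisym; reflexive; module Eq) renaming (refl to ≤-refl; trans to ≤-trans)

  infixr 5 _∙_
  _∙_ : {x y z : Carrier} → x ≤ y → y ≤ z → x ≤ z
  _∙_ = ≤-trans

  ≈⇒≥ : {x y : Carrier} → x ≈ y → y ≤ x
  ≈⇒≥ x≈y = reflexive (Eq.sym x≈y)

  ⊓-mono : {a b c d : Carrier} → a ≤ b → c ≤ d → a ⊓ c ≤ b ⊓ d
  ⊓-mono a≤b c≤d = ⊓-glb _ _ _ (⊓-lb₁ _ _ ∙ a≤b) (⊓-lb₂ _ _ ∙ c≤d)

  ⊔-mono : {a b c d : Carrier} → a ≤ b → c ≤ d → a ⊔ c ≤ b ⊔ d
  ⊔-mono a≤b c≤d = ⊔-lub _ _ _ (a≤b ∙ ⊔-ub₁ _ _) (c≤d ∙ ⊔-ub₂ _ _)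

  ⊓-comm : {a b : Carrier} → a ⊓ b ≤ b ⊓ a
  ⊓-comm = ⊓-glb _ _ _ (⊓-lb₂ _ _) (⊓-lb₁ _ _)

  ⊔-comm : {a b : Carrier} → a ⊔ b ≤ b ⊔ a
  ⊔-comm = ⊔-lub _ _ _ (⊔-ub₂ _ _) (⊔-ub₁ _ _)

  ≤-by-cases : {g c d : Carrier} → g ⊓ c ≤ d → g ⊓ (- c) ≤ d → g ≤ d
  ≤-by-cases {g} {c} g⊓c≤d g⊓-c≤d =
    ⊓-glb _ _ _ ≤-refl (⊤-max g ∙ ≈⇒≥ (compl-⊔ c)) ∙ distrib _ _ _ ∙ ⊔-lub _ _ _ g⊓c≤d g⊓-c≤d

  disjunctive-syllogism : {g c d : Carrier} → g ≤ c ⊔ d → g ⊓ (- c) ≤ d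
  disjunctive-syllogism {c = c} {d} g≤c⊔d = ⊓-comm ∙ ⊓-mono ≤-refl g≤c⊔d ∙ distrib _ _ _ ∙
    ⊔-lub _ _ _ (⊓-comm ∙ reflexive (compl-⊓ c) ∙ ⊥-min d) (⊓-lb₂ _ _)

  cut-≤ : {g c d : Carrier} → g ≤ c ⊔ d → g ⊓ c ≤ d → g ≤ d
  cut-≤ g≤c⊔d g⊓c≤d = ≤-by-cases g⊓c≤d (disjunctive-syllogism g≤c⊔d)

  shunt : {a b d : Carrier} → a ⊓ b ≤ d → b ≤ d ⊔ (- a)
  shunt a⊓b≤d = ≤-by-cases (⊓-comm ∙ a⊓b≤d ∙ ⊔-ub₁ _ _) (⊓-lb₂ _ _ ∙ ⊔-ub₂ _ _)

  unshunt : {a b d : Carrier} → b ≤ d ⊔ (- a) → a ⊓ b ≤ d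
  unshunt {a} {d = d} b≤d⊔-a = ⊓-mono ≤-refl b≤d⊔-a ∙ distrib _ _ _ ∙
    ⊔-lub _ _ _ (⊓-lb₂ _ _) (reflexive (compl-⊓ a) ∙ ⊥-min d)

  ⊓-⊔-lub : {g a b d : Carrier} → g ⊓ a ≤ d → g ⊓ b ≤ d → g ⊓ (a ⊔ b) ≤ d
  ⊓-⊔-lub g⊓a≤d g⊓b≤d = distrib _ _ _ ∙ ⊔-lub _ _ _ g⊓a≤d g⊓b≤d

  ⊔-⊓-glb : {g a b d : Carrier} → g ≤ a ⊔ d → g ≤ b ⊔ d → g ≤ (a ⊓ b) ⊔ d
  ⊔-⊓-glb g≤a⊔d g≤b⊔d = ≤-by-cases (⊓-lb₂ _ _ ∙ ⊔-ub₂ _ _)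
    (⊓-glb _ _ _ (disjunctive-syllogism (g≤a⊔d ∙ ⊔-comm)) (disjunctive-syllogism (g≤b⊔d ∙ ⊔-comm))
      ∙ ⊔-ub₁ _ _)

  compl-antitone : {a b : Carrier} → a ≤ b → - b ≤ - a
  compl-antitone {b = b} a≤b =
    ≤-by-cases (⊓-mono ≤-refl a≤b ∙ ⊓-comm ∙ reflexive (compl-⊓ b) ∙ ⊥-min _) (⊓-lb₂ _ _)

  ⋁-mono : {I : Set} {f g : I → Carrier} → (∀ i → f i ≤ g i) → ⋁ f ≤ ⋁ g
  ⋁-mono {g = g} f≤g = ⋁-lub _ _ (λ i → f≤g i ∙ ⋁-ub g i)

  ⋀-mono : {I : Set} {f g : I → Carrier} → (∀ i → f i ≤ g i) → ⋀ f ≤ ⋀ g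
  ⋀-mono {f = f} f≤g = ⋀-glb _ _ (λ i → ⋀-lb f i ∙ f≤g i)

  ⊓-⋁-lub : {I : Set} {f : I → Carrier} {g d : Carrier} → (∀ i → g ⊓ f i ≤ d) → g ⊓ ⋁ f ≤ d
  ⊓-⋁-lub g⊓f≤d = unshunt (⋁-lub _ _ (λ i → shunt (g⊓f≤d i)))

  ⋀-⊔-glb : {I : Set} {f : I → Carrier} {g d : Carrier} → (∀ i → g ≤ f i ⊔ d) → g ≤ ⋀ f ⊔ d
  ⋀-⊔-glb g≤f⊔d = ≤-by-cases (⊓-lb₂ _ _ ∙ ⊔-ub₂ _ _)
    (⋀-glb _ _ (λ i → disjunctive-syllogism (g≤f⊔d i ∙ ⊔-comm)) ∙ ⊔-ub₁ _ _)

  compl-cong : {a b : Carrier} → a ≈ b → - a ≈ - b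
  compl-cong a≈b = antisym (compl-antitone (≈⇒≥ a≈b)) (compl-antitone (reflexive a≈b))

  ⊓-cong : {a b c d : Carrier} → a ≈ b → c ≈ d → a ⊓ c ≈ b ⊓ d
  ⊓-cong a≈b c≈d = antisym (⊓-mono (reflexive a≈b) (reflexive c≈d)) (⊓-mono (≈⇒≥ a≈b) (≈⇒≥ c≈d))

  ⊔-cong : {a b c d : Carrier} → a ≈ b → c ≈ d → a ⊔ c ≈ b ⊔ d
  ⊔-cong a≈b c≈d = antisym (⊔-mono (reflexive a≈b) (reflexive c≈d)) (⊔-mono (≈⇒≥ a≈b) (≈⇒≥ c≈d))

  ⋁-cong : {I : Set} {f g : I → Carrier} → (∀ i → f i ≈ g i) → ⋁ f ≈ ⋁ g
  ⋁-cong f≈g = antisym (⋁-mono (reflexive ∘ f≈g)) (⋁-mono (≈⇒≥ ∘ f≈g))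

  ⋀-cong : {I : Set} {f g : I → Carrier} → (∀ i → f i ≈ g i) → ⋀ f ≈ ⋀ g
  ⋀-cong f≈g = antisym (⋀-mono (reflexive ∘ f≈g)) (⋀-mono (≈⇒≥ ∘ f≈g))

module Intervals (B : CompleteBooleanAlgebra) where
  open CompleteBooleanAlgebraProperties B

  infix 4 _⊴ᴰ_
  _⊴ᴰ_ : D B → Pair B → Set
  y ⊴ᴰ p = _⊴_ B (∣_∣ B y) p

  record Between (a : D B) (x : Carrier) : Set where
    constructor between
    field
      lower : □ a ≤ x
      upper : x ≤ ◇ a
  open Between public

  between-resp : {a : D B} {x x' : Carrier} → x ≈ x' → Between a x → Between a x'
  between-resp x≈x' (between □a≤x x≤◇a) = between (□a≤x ∙ reflexive x≈x') (≈⇒≥ x≈x' ∙ x≤◇a)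

  between-¬ : {a y : D B} {x : Carrier} → y ⊴ᴰ negD B a → Between a x → Between y (- x)
  between-¬ (□y≤ , ≤◇y) (between □a≤x x≤◇a) =
    between (□y≤ ∙ compl-antitone x≤◇a) (compl-antitone □a≤x ∙ ≤◇y)

  between-∨ : {a b y : D B} {x x' : Carrier} → y ⊴ᴰ sup< B (two B a b) →
    Between a x → Between b x' → Between y (x ⊔ x')
  between-∨ (□y≤ , ≤◇y) (between □a≤x x≤◇a) (between □b≤x' x'≤◇b) = between
    (□y≤ ∙ ⋁-lub _ _ (λ { false → □a≤x ∙ ⊔-ub₁ _ _ ; true → □b≤x' ∙ ⊔-ub₂ _ _ }))
    (⊔-lub _ _ _ (x≤◇a ∙ ⋁-ub _ false) (x'≤◇b ∙ ⋁-ub _ true) ∙ ≤◇y)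

  between-∧ : {a b y : D B} {x x' : Carrier} → y ⊴ᴰ inf< B (two B a b) →
    Between a x → Between b x' → Between y (x ⊓ x')
  between-∧ (□y≤ , ≤◇y) (between □a≤x x≤◇a) (between □b≤x' x'≤◇b) = between
    (□y≤ ∙ ⊓-glb _ _ _ (⋀-lb _ false ∙ □a≤x) (⋀-lb _ true ∙ □b≤x'))
    (⋀-glb _ _ (λ { false → ⊓-lb₁ _ _ ∙ x≤◇a ; true → ⊓-lb₂ _ _ ∙ x'≤◇b }) ∙ ≤◇y)

  between-⋁ : {I J : Set} (f : I → D B) {g : J → Carrier} {y : D B} → y ⊴ᴰ sup< B f →
    (∀ i → Σ J λ j → □ (f i) ≤ g j) → (∀ j → Σ I λ i → g j ≤ ◇ (f i)) → Between y (⋁ g)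
  between-⋁ f (□y≤ , ≤◇y) below above = between
    (□y≤ ∙ ⋁-lub _ _ (λ i → proj₂ (below i) ∙ ⋁-ub _ (proj₁ (below i))))
    (⋁-lub _ _ (λ j → proj₂ (above j) ∙ ⋁-ub _ (proj₁ (above j))) ∙ ≤◇y)

  between-⋀ : {I J : Set} (f : I → D B) {g : J → Carrier} {y : D B} → y ⊴ᴰ inf< B f →
    (∀ j → Σ I λ i → □ (f i) ≤ g j) → (∀ i → Σ J λ j → g j ≤ ◇ (f i)) → Between y (⋀ g)
  between-⋀ f (□y≤ , ≤◇y) below above = between
    (□y≤ ∙ ⋀-glb _ _ (λ j → ⋀-lb _ (proj₁ (below j)) ∙ proj₂ (below j)))
    (⋀-glb _ _ (λ i → ⋀-lb _ (proj₁ (above i)) ∙ proj₂ (above i)) ∙ ≤◇y)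

Assignment : (ℕ → Set) → List ℕ → Set
Assignment P Σ = ∀ {k} → k ∈ Σ → P k

infixr 5 _∷ᵃ_
_∷ᵃ_ : {P : ℕ → Set} {k : ℕ} → P k → Assignment P Σ₀ → Assignment P (k ∷ Σ₀)
(x ∷ᵃ γ) (here refl) = x
(x ∷ᵃ γ) (there p)   = γ p

module Semantics (B : CompleteBooleanAlgebra) (SV : SemiValuation B) where
  open CompleteBooleanAlgebraProperties B
  open Intervals B
  open SemiValuation SV

  Pred : ℕ → Set
  Pred k = Vec ℕ (suc k) → Carrier

  record Candidate (k : ℕ) : Set where
    field
      term   : Abs k
      extent : Pred k
      bounds : ∀ v → Between (V (apply (abs term) (map fv v))) (extent v)
  open Candidate public

  FreeCandidates : Set
  FreeCandidates = (k x : ℕ) → Candidate k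

  []ᵖ : Assignment Pred []
  []ᵖ ()

  evalT : (Fin m → ℕ) → (ℕ → ℕ) → Term m → ℕ
  evalT β π₀ (fv a) = π₀ a
  evalT β π₀ (bv i) = β i

  ⟦_⟧ : Formula m Σ₀ → (Fin m → ℕ) → Assignment Pred Σ₀ → (ℕ → ℕ) → FreeCandidates → Carrier
  ⟦ fatom k x ts ⟧ β γ π₀ π₁ = extent (π₁ k x) (map (evalT β π₀) ts)
  ⟦ batom p ts ⟧   β γ π₀ π₁ = γ p (map (evalT β π₀) ts)
  ⟦ ¬' F ⟧         β γ π₀ π₁ = - ⟦ F ⟧ β γ π₀ π₁
  ⟦ F ∨' G ⟧       β γ π₀ π₁ = ⟦ F ⟧ β γ π₀ π₁ ⊔ ⟦ G ⟧ β γ π₀ π₁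
  ⟦ F ∧' G ⟧       β γ π₀ π₁ = ⟦ F ⟧ β γ π₀ π₁ ⊓ ⟦ G ⟧ β γ π₀ π₁
  ⟦ ∃⁰ F ⟧         β γ π₀ π₁ = ⋁ λ (n : ℕ) → ⟦ F ⟧ (n ∷ᶠ β) γ π₀ π₁
  ⟦ ∀⁰ F ⟧         β γ π₀ π₁ = ⋀ λ (n : ℕ) → ⟦ F ⟧ (n ∷ᶠ β) γ π₀ π₁
  ⟦ ∃¹ k F ⟧       β γ π₀ π₁ = ⋁ λ (c : Candidate k) → ⟦ F ⟧ β (extent c ∷ᵃ γ) π₀ π₁
  ⟦ ∀¹ k F ⟧       β γ π₀ π₁ = ⋀ λ (c : Candidate k) → ⟦ F ⟧ β (extent c ∷ᵃ γ) π₀ π₁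

  _≈ᵃ_ : Assignment Pred Σ₀ → Assignment Pred Σ₀ → Set
  γ ≈ᵃ γ' = ∀ {k} (p : k ∈ _) v → γ p v ≈ γ' p v

  ∷ᵃ-cong : {k : ℕ} (P : Pred k) {γ γ' : Assignment Pred Σ₀} → γ ≈ᵃ γ' → (P ∷ᵃ γ) ≈ᵃ (P ∷ᵃ γ')
  ∷ᵃ-cong P γ≈γ' (here refl) v = Eq.refl
  ∷ᵃ-cong P γ≈γ' (there p)   v = γ≈γ' p v

  ∷ᶠ-cong : {β β' : Fin m → ℕ} (n : ℕ) → β ≗ β' → (n ∷ᶠ β) ≗ (n ∷ᶠ β')
  ∷ᶠ-cong n β≗β' zero    = refl
  ∷ᶠ-cong n β≗β' (suc i) = β≗β' i

  map-evalT-cong : {β β' : Fin m → ℕ} {π₀ π₀' : ℕ → ℕ} → β ≗ β' → (ts : Vec (Term m) n) →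
    (∀ a → VAny.Any (occT a) ts → π₀ a ≡ π₀' a) → map (evalT β π₀) ts ≡ map (evalT β' π₀') ts
  map-evalT-cong β≗β' []          π₀≡π₀' = refl
  map-evalT-cong β≗β' (fv a ∷ ts) π₀≡π₀' =
    cong₂ _∷_ (π₀≡π₀' a (VAny.here refl)) (map-evalT-cong β≗β' ts (λ b o → π₀≡π₀' b (VAny.there o)))
  map-evalT-cong β≗β' (bv i ∷ ts) π₀≡π₀' =
    cong₂ _∷_ (β≗β' i) (map-evalT-cong β≗β' ts (λ b o → π₀≡π₀' b (VAny.there o)))

  ⟦⟧-cong : {β β' : Fin m → ℕ} {γ γ' : Assignment Pred Σ₀} {π₀ π₀' : ℕ → ℕ} {π₁ π₁' : FreeCandidates}
    (F : Formula m Σ₀) → β ≗ β' → γ ≈ᵃ γ' →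
    (∀ a → occ⁰ a F → π₀ a ≡ π₀' a) → (∀ k x → occ¹ k x F → ∀ v → extent (π₁ k x) v ≈ extent (π₁' k x) v) →
    ⟦ F ⟧ β γ π₀ π₁ ≈ ⟦ F ⟧ β' γ' π₀' π₁'
  ⟦⟧-cong {π₁' = π₁'} (fatom k x ts) β≗β' γ≈γ' π₀≡π₀' π₁≈π₁' =
    Eq.trans (π₁≈π₁' k x (refl , refl) _)
      (Eq.reflexive (cong (extent (π₁' k x)) (map-evalT-cong β≗β' ts π₀≡π₀')))
  ⟦⟧-cong {γ' = γ'} (batom p ts) β≗β' γ≈γ' π₀≡π₀' π₁≈π₁' =
    Eq.trans (γ≈γ' p _) (Eq.reflexive (cong (γ' p) (map-evalT-cong β≗β' ts π₀≡π₀')))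
  ⟦⟧-cong (¬' F) β≗β' γ≈γ' π₀≡π₀' π₁≈π₁' = compl-cong (⟦⟧-cong F β≗β' γ≈γ' π₀≡π₀' π₁≈π₁')
  ⟦⟧-cong (F ∨' G) β≗β' γ≈γ' π₀≡π₀' π₁≈π₁' =
    ⊔-cong (⟦⟧-cong F β≗β' γ≈γ' (λ a → π₀≡π₀' a ∘ inj₁) (λ k x → π₁≈π₁' k x ∘ inj₁))
           (⟦⟧-cong G β≗β' γ≈γ' (λ a → π₀≡π₀' a ∘ inj₂) (λ k x → π₁≈π₁' k x ∘ inj₂))
  ⟦⟧-cong (F ∧' G) β≗β' γ≈γ' π₀≡π₀' π₁≈π₁' =
    ⊓-cong (⟦⟧-cong F β≗β' γ≈γ' (λ a → π₀≡π₀' a ∘ inj₁) (λ k x → π₁≈π₁' k x ∘ inj₁))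
           (⟦⟧-cong G β≗β' γ≈γ' (λ a → π₀≡π₀' a ∘ inj₂) (λ k x → π₁≈π₁' k x ∘ inj₂))
  ⟦⟧-cong (∃⁰ F) β≗β' γ≈γ' π₀≡π₀' π₁≈π₁' = ⋁-cong λ n → ⟦⟧-cong F (∷ᶠ-cong n β≗β') γ≈γ' π₀≡π₀' π₁≈π₁'
  ⟦⟧-cong (∀⁰ F) β≗β' γ≈γ' π₀≡π₀' π₁≈π₁' = ⋀-cong λ n → ⟦⟧-cong F (∷ᶠ-cong n β≗β') γ≈γ' π₀≡π₀' π₁≈π₁'
  ⟦⟧-cong (∃¹ k F) β≗β' γ≈γ' π₀≡π₀' π₁≈π₁' =
    ⋁-cong λ c → ⟦⟧-cong F β≗β' (∷ᵃ-cong (extent c) γ≈γ') π₀≡π₀' π₁≈π₁'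
  ⟦⟧-cong (∀¹ k F) β≗β' γ≈γ' π₀≡π₀' π₁≈π₁' =
    ⋀-cong λ c → ⟦⟧-cong F β≗β' (∷ᵃ-cong (extent c) γ≈γ') π₀≡π₀' π₁≈π₁'

  ⟦⟧-cong-bound : {β β' : Fin m → ℕ} {γ γ' : Assignment Pred Σ₀} {π₀ : ℕ → ℕ} {π₁ : FreeCandidates}
    (F : Formula m Σ₀) → β ≗ β' → γ ≈ᵃ γ' → ⟦ F ⟧ β γ π₀ π₁ ≈ ⟦ F ⟧ β' γ' π₀ π₁
  ⟦⟧-cong-bound F β≗β' γ≈γ' = ⟦⟧-cong F β≗β' γ≈γ' (λ a o → refl) (λ k x o v → Eq.refl)

  evalT-liftS : (β : Fin m' → ℕ) (π₀ : ℕ → ℕ) (σ : Fin m → Term m') (n : ℕ) →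
    evalT (n ∷ᶠ β) π₀ ∘ liftS σ ≗ n ∷ᶠ (evalT β π₀ ∘ σ)
  evalT-liftS β π₀ σ n zero = refl
  evalT-liftS β π₀ σ n (suc i) with σ i
  ... | fv a = refl
  ... | bv j = refl

  evalT-substT : (β : Fin m' → ℕ) (π₀ : ℕ → ℕ) (σ : Fin m → Term m') →
    evalT β π₀ ∘ substT σ ≗ evalT (evalT β π₀ ∘ σ) π₀
  evalT-substT β π₀ σ (fv a) = refl
  evalT-substT β π₀ σ (bv i) = refl

  ⟦⟧-subst⁰ : (σ : Fin m → Term m') (F : Formula m Σ₀) (β : Fin m' → ℕ) (γ : Assignment Pred Σ₀)
    (π₀ : ℕ → ℕ) (π₁ : FreeCandidates) → ⟦ subst⁰ σ F ⟧ β γ π₀ π₁ ≈ ⟦ F ⟧ (evalT β π₀ ∘ σ) γ π₀ π₁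
  ⟦⟧-subst⁰ σ (fatom k x ts) β γ π₀ π₁ =
    Eq.reflexive (cong (extent (π₁ k x)) (map-fusion (evalT-substT β π₀ σ) ts))
  ⟦⟧-subst⁰ σ (batom p ts)   β γ π₀ π₁ = Eq.reflexive (cong (γ p) (map-fusion (evalT-substT β π₀ σ) ts))
  ⟦⟧-subst⁰ σ (¬' F)         β γ π₀ π₁ = compl-cong (⟦⟧-subst⁰ σ F β γ π₀ π₁)
  ⟦⟧-subst⁰ σ (F ∨' G)       β γ π₀ π₁ = ⊔-cong (⟦⟧-subst⁰ σ F β γ π₀ π₁) (⟦⟧-subst⁰ σ G β γ π₀ π₁)
  ⟦⟧-subst⁰ σ (F ∧' G)       β γ π₀ π₁ = ⊓-cong (⟦⟧-subst⁰ σ F β γ π₀ π₁) (⟦⟧-subst⁰ σ G β γ π₀ π₁)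
  ⟦⟧-subst⁰ σ (∃⁰ F)         β γ π₀ π₁ = ⋁-cong λ n →
    Eq.trans (⟦⟧-subst⁰ (liftS σ) F (n ∷ᶠ β) γ π₀ π₁)
      (⟦⟧-cong-bound F (evalT-liftS β π₀ σ n) (λ p v → Eq.refl))
  ⟦⟧-subst⁰ σ (∀⁰ F)         β γ π₀ π₁ = ⋀-cong λ n →
    Eq.trans (⟦⟧-subst⁰ (liftS σ) F (n ∷ᶠ β) γ π₀ π₁)
      (⟦⟧-cong-bound F (evalT-liftS β π₀ σ n) (λ p v → Eq.refl))
  ⟦⟧-subst⁰ σ (∃¹ k F)       β γ π₀ π₁ = ⋁-cong λ c → ⟦⟧-subst⁰ σ F β (extent c ∷ᵃ γ) π₀ π₁
  ⟦⟧-subst⁰ σ (∀¹ k F)       β γ π₀ π₁ = ⋀-cong λ c → ⟦⟧-subst⁰ σ F β (extent c ∷ᵃ γ) π₀ π₁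

  ∷ᵃ-liftR¹ : {j : ℕ} (P : Pred j) (γ : Assignment Pred Σ₂) (r : Ren¹ Σ₁ Σ₂) →
    ((P ∷ᵃ γ) ∘ liftR¹ r) ≈ᵃ (P ∷ᵃ (γ ∘ r))
  ∷ᵃ-liftR¹ P γ r (here refl) v = Eq.refl
  ∷ᵃ-liftR¹ P γ r (there p)   v = Eq.refl

  ⟦⟧-ren¹ : (r : Ren¹ Σ₁ Σ₂) (F : Formula m Σ₁) (β : Fin m → ℕ) (γ : Assignment Pred Σ₂)
    (π₀ : ℕ → ℕ) (π₁ : FreeCandidates) → ⟦ ren¹ r F ⟧ β γ π₀ π₁ ≈ ⟦ F ⟧ β (γ ∘ r) π₀ π₁
  ⟦⟧-ren¹ r (fatom k x ts) β γ π₀ π₁ = Eq.refl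
  ⟦⟧-ren¹ r (batom p ts)   β γ π₀ π₁ = Eq.refl
  ⟦⟧-ren¹ r (¬' F)         β γ π₀ π₁ = compl-cong (⟦⟧-ren¹ r F β γ π₀ π₁)
  ⟦⟧-ren¹ r (F ∨' G)       β γ π₀ π₁ = ⊔-cong (⟦⟧-ren¹ r F β γ π₀ π₁) (⟦⟧-ren¹ r G β γ π₀ π₁)
  ⟦⟧-ren¹ r (F ∧' G)       β γ π₀ π₁ = ⊓-cong (⟦⟧-ren¹ r F β γ π₀ π₁) (⟦⟧-ren¹ r G β γ π₀ π₁)
  ⟦⟧-ren¹ r (∃⁰ F)         β γ π₀ π₁ = ⋁-cong λ n → ⟦⟧-ren¹ r F (n ∷ᶠ β) γ π₀ π₁
  ⟦⟧-ren¹ r (∀⁰ F)         β γ π₀ π₁ = ⋀-cong λ n → ⟦⟧-ren¹ r F (n ∷ᶠ β) γ π₀ π₁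
  ⟦⟧-ren¹ r (∃¹ k F)       β γ π₀ π₁ = ⋁-cong λ c → Eq.trans (⟦⟧-ren¹ (liftR¹ r) F β (extent c ∷ᵃ γ) π₀ π₁)
    (⟦⟧-cong-bound F (λ i → refl) (∷ᵃ-liftR¹ (extent c) γ r))
  ⟦⟧-ren¹ r (∀¹ k F)       β γ π₀ π₁ = ⋀-cong λ c → Eq.trans (⟦⟧-ren¹ (liftR¹ r) F β (extent c ∷ᵃ γ) π₀ π₁)
    (⟦⟧-cong-bound F (λ i → refl) (∷ᵃ-liftR¹ (extent c) γ r))

  ⟦_⟧ᵛ : {k : ℕ} → SOVal Σ₀ k → Assignment Pred Σ₀ → (ℕ → ℕ) → FreeCandidates → Pred k
  ⟦ var q ⟧ᵛ γ π₀ π₁ = γ q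
  ⟦ abs G ⟧ᵛ γ π₀ π₁ = λ v → ⟦ G ⟧ (lookup v) []ᵖ π₀ π₁

  ⟦⟧ᵛ-liftSub¹ : {j : ℕ} (P : Pred j) (γ : Assignment Pred Σ₂) (π₀ : ℕ → ℕ) (π₁ : FreeCandidates)
    (τ : Sub¹ Σ₁ Σ₂) → (λ p → ⟦ liftSub¹ τ p ⟧ᵛ (P ∷ᵃ γ) π₀ π₁) ≈ᵃ (P ∷ᵃ (λ p → ⟦ τ p ⟧ᵛ γ π₀ π₁))
  ⟦⟧ᵛ-liftSub¹ P γ π₀ π₁ τ (here refl) v = Eq.refl
  ⟦⟧ᵛ-liftSub¹ P γ π₀ π₁ τ (there p)   v with τ p
  ... | var q = Eq.refl
  ... | abs G = Eq.refl

  ⟦⟧-sub¹ : (τ : Sub¹ Σ₁ Σ₂) (F : Formula m Σ₁) (β : Fin m → ℕ) (γ : Assignment Pred Σ₂)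
    (π₀ : ℕ → ℕ) (π₁ : FreeCandidates) → ⟦ sub¹ τ F ⟧ β γ π₀ π₁ ≈ ⟦ F ⟧ β (λ p → ⟦ τ p ⟧ᵛ γ π₀ π₁) π₀ π₁
  ⟦⟧-sub¹ τ (fatom k x ts) β γ π₀ π₁ = Eq.refl
  ⟦⟧-sub¹ τ (batom p ts)   β γ π₀ π₁ with τ p
  ... | var q = Eq.refl
  ... | abs G = Eq.trans (⟦⟧-ren¹ noBound (subst⁰ (lookup ts) G) β γ π₀ π₁)
                (Eq.trans (⟦⟧-subst⁰ (lookup ts) G β (γ ∘ noBound) π₀ π₁)
                  (⟦⟧-cong-bound G (λ i → sym (lookup-map i (evalT β π₀) ts)) (λ ())))
  ⟦⟧-sub¹ τ (¬' F)         β γ π₀ π₁ = compl-cong (⟦⟧-sub¹ τ F β γ π₀ π₁)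
  ⟦⟧-sub¹ τ (F ∨' G)       β γ π₀ π₁ = ⊔-cong (⟦⟧-sub¹ τ F β γ π₀ π₁) (⟦⟧-sub¹ τ G β γ π₀ π₁)
  ⟦⟧-sub¹ τ (F ∧' G)       β γ π₀ π₁ = ⊓-cong (⟦⟧-sub¹ τ F β γ π₀ π₁) (⟦⟧-sub¹ τ G β γ π₀ π₁)
  ⟦⟧-sub¹ τ (∃⁰ F)         β γ π₀ π₁ = ⋁-cong λ n → ⟦⟧-sub¹ τ F (n ∷ᶠ β) γ π₀ π₁
  ⟦⟧-sub¹ τ (∀⁰ F)         β γ π₀ π₁ = ⋀-cong λ n → ⟦⟧-sub¹ τ F (n ∷ᶠ β) γ π₀ π₁
  ⟦⟧-sub¹ τ (∃¹ k F)       β γ π₀ π₁ = ⋁-cong λ c →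
    Eq.trans (⟦⟧-sub¹ (liftSub¹ τ) F β (extent c ∷ᵃ γ) π₀ π₁)
    (⟦⟧-cong-bound F (λ i → refl) (⟦⟧ᵛ-liftSub¹ (extent c) γ π₀ π₁ τ))
  ⟦⟧-sub¹ τ (∀¹ k F)       β γ π₀ π₁ = ⋀-cong λ c →
    Eq.trans (⟦⟧-sub¹ (liftSub¹ τ) F β (extent c ∷ᵃ γ) π₀ π₁)
    (⟦⟧-cong-bound F (λ i → refl) (⟦⟧ᵛ-liftSub¹ (extent c) γ π₀ π₁ τ))

  []ᶜ : Assignment Candidate []
  []ᶜ ()

  ⟦_⟧ᶜ : Formula m Σ₀ → (Fin m → ℕ) → Assignment Candidate Σ₀ → (ℕ → ℕ) → FreeCandidates → Carrier
  ⟦ F ⟧ᶜ β γ π₀ π₁ = ⟦ F ⟧ β (λ p → extent (γ p)) π₀ π₁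

  close : (Fin m → ℕ) → Assignment Candidate Σ₀ → (ℕ → ℕ) → FreeCandidates → Formula m Σ₀ → Fm
  close β γ π₀ π₁ = substAll (fv ∘ β) (λ p → abs (term (γ p))) π₀ (λ k x → term (π₁ k x))

  closeBody⁰ : (Fin m → ℕ) → Assignment Candidate Σ₀ → (ℕ → ℕ) → FreeCandidates →
    Formula (suc m) Σ₀ → Formula 1 []
  closeBody⁰ β γ π₀ π₁ = substAll (liftS (fv ∘ β)) (λ p → abs (term (γ p))) π₀ (λ k x → term (π₁ k x))

  closeBody¹ : {k : ℕ} → (Fin m → ℕ) → Assignment Candidate Σ₀ → (ℕ → ℕ) → FreeCandidates →
    Formula m (k ∷ Σ₀) → Formula 0 (k ∷ [])
  closeBody¹ β γ π₀ π₁ = substAll (fv ∘ β) (liftSub¹ (λ p → abs (term (γ p)))) π₀ (λ k x → term (π₁ k x))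

  lowerCandidate : {k : ℕ} → Abs k → Candidate k
  lowerCandidate T = record
    { term   = T
    ; extent = λ v → □ (V (apply (abs T) (map fv v)))
    ; bounds = λ v → between ≤-refl (□≤◇ (V (apply (abs T) (map fv v))))
    }

  map-substAllT-fv : (β : Fin m → ℕ) (π₀ : ℕ → ℕ) (ts : Vec (Term m) n) →
    map (substAllT (fv {0} ∘ β) π₀) ts ≡ map fv (map (evalT β π₀) ts)
  map-substAllT-fv β π₀ ts = sym (map-fusion (λ { (fv a) → refl ; (bv i) → refl }) ts)

  apply-between : {k : ℕ} (c : Candidate k) (β : Fin m → ℕ) (π₀ : ℕ → ℕ) (ts : Vec (Term m) (suc k)) →
    Between (V (apply (abs (term c)) (map (substAllT (fv ∘ β) π₀) ts))) (extent c (map (evalT β π₀) ts))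
  apply-between c β π₀ ts =
    subst (λ us → Between (V (apply (abs (term c)) us)) (extent c (map (evalT β π₀) ts)))
    (sym (map-substAllT-fv β π₀ ts)) (bounds c (map (evalT β π₀) ts))

  close-inst⁰ : (F : Formula (suc m) Σ₀) (β : Fin m → ℕ) (γ : Assignment Candidate Σ₀) (π₀ : ℕ → ℕ)
    (π₁ : FreeCandidates) (n : ℕ) →
    inst⁰ (closeBody⁰ β γ π₀ π₁ F) n ≡
    close (n ∷ᶠ β) γ π₀ π₁ F
  close-inst⁰ F β γ π₀ π₁ n = trans (subst⁰-substAll (λ _ → fv n) (liftS (fv ∘ β)) _ π₀ _ F)
    (substAll-cong π₀ _ (λ { zero → refl ; (suc i) → refl }) (λ p → refl) F)

  close-inst¹ : {k : ℕ} (F : Formula m (k ∷ Σ₀)) (β : Fin m → ℕ) (γ : Assignment Candidate Σ₀)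
    (π₀ : ℕ → ℕ) (π₁ : FreeCandidates) (c : Candidate k) →
    inst¹ (closeBody¹ β γ π₀ π₁ F) (term c) ≡
    close β (c ∷ᵃ γ) π₀ π₁ F
  close-inst¹ F β γ π₀ π₁ c = trans (sub¹-substAll _ (fv ∘ β) (liftSub¹ (λ p → abs (term (γ p)))) π₀ _ F)
    (substAll-cong π₀ _ (λ i → refl) (λ { (here refl) → refl ; (there p) → refl }) F)

  extent-∷ᵃ : {k : ℕ} (c : Candidate k) (γ : Assignment Candidate Σ₀) →
    (λ p → extent ((c ∷ᵃ γ) p)) ≈ᵃ (extent c ∷ᵃ (λ p → extent (γ p)))
  extent-∷ᵃ c γ (here refl) v = Eq.refl
  extent-∷ᵃ c γ (there p)   v = Eq.refl

  close-between : (F : Formula m Σ₀) (β : Fin m → ℕ) (γ : Assignment Candidate Σ₀) (π₀ : ℕ → ℕ)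
    (π₁ : FreeCandidates) → Between (V (close β γ π₀ π₁ F)) (⟦ F ⟧ᶜ β γ π₀ π₁)

  close-between-inst⁰ : (F : Formula (suc m) Σ₀) (β : Fin m → ℕ) (γ : Assignment Candidate Σ₀)
    (π₀ : ℕ → ℕ) (π₁ : FreeCandidates) (n : ℕ) →
    Between (V (inst⁰ (closeBody⁰ β γ π₀ π₁ F) n))
            (⟦ F ⟧ᶜ (n ∷ᶠ β) γ π₀ π₁)
  close-between-inst⁰ F β γ π₀ π₁ n = subst (λ A → Between (V A) (⟦ F ⟧ᶜ (n ∷ᶠ β) γ π₀ π₁))
    (sym (close-inst⁰ F β γ π₀ π₁ n)) (close-between F (n ∷ᶠ β) γ π₀ π₁)

  close-between-inst¹ : {k : ℕ} (F : Formula m (k ∷ Σ₀)) (β : Fin m → ℕ) (γ : Assignment Candidate Σ₀)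
    (π₀ : ℕ → ℕ) (π₁ : FreeCandidates) (c : Candidate k) →
    Between (V (inst¹ (closeBody¹ β γ π₀ π₁ F)
                      (term c)))
            (⟦ F ⟧ β (extent c ∷ᵃ (λ p → extent (γ p))) π₀ π₁)
  close-between-inst¹ F β γ π₀ π₁ c =
    between-resp (⟦⟧-cong-bound F (λ i → refl) (extent-∷ᵃ c γ))
      (subst (λ A → Between (V A) (⟦ F ⟧ᶜ β (c ∷ᵃ γ) π₀ π₁))
        (sym (close-inst¹ F β γ π₀ π₁ c)) (close-between F β (c ∷ᵃ γ) π₀ π₁))

  close-between (fatom k x ts) β γ π₀ π₁ = apply-between (π₁ k x) β π₀ ts
  close-between (batom p ts)   β γ π₀ π₁ = apply-between (γ p) β π₀ ts
  close-between (¬' F)         β γ π₀ π₁ = between-¬ (V¬ (close β γ π₀ π₁ F)) (close-between F β γ π₀ π₁)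
  close-between (F ∨' G)       β γ π₀ π₁ =
    between-∨ (V∨ (close β γ π₀ π₁ F) (close β γ π₀ π₁ G))
      (close-between F β γ π₀ π₁) (close-between G β γ π₀ π₁)
  close-between (F ∧' G)       β γ π₀ π₁ =
    between-∧ (V∧ (close β γ π₀ π₁ F) (close β γ π₀ π₁ G))
      (close-between F β γ π₀ π₁) (close-between G β γ π₀ π₁)
  close-between (∃⁰ F)         β γ π₀ π₁ = between-⋁ (V ∘ inst⁰ (closeBody⁰ β γ π₀ π₁ F)) (V∃⁰ _)
    (λ n → n , lower (close-between-inst⁰ F β γ π₀ π₁ n))
    (λ n → n , upper (close-between-inst⁰ F β γ π₀ π₁ n))
  close-between (∀⁰ F)         β γ π₀ π₁ = between-⋀ (V ∘ inst⁰ (closeBody⁰ β γ π₀ π₁ F)) (V∀⁰ _)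
    (λ n → n , lower (close-between-inst⁰ F β γ π₀ π₁ n))
    (λ n → n , upper (close-between-inst⁰ F β γ π₀ π₁ n))
  close-between (∃¹ k F)       β γ π₀ π₁ = between-⋁ (V ∘ inst¹ (closeBody¹ β γ π₀ π₁ F)) (V∃¹ k _)
    (λ T → lowerCandidate T , lower (close-between-inst¹ F β γ π₀ π₁ (lowerCandidate T)))
    (λ c → term c , upper (close-between-inst¹ F β γ π₀ π₁ c))
  close-between (∀¹ k F)       β γ π₀ π₁ = between-⋀ (V ∘ inst¹ (closeBody¹ β γ π₀ π₁ F)) (V∀¹ k _)
    (λ c → term c , lower (close-between-inst¹ F β γ π₀ π₁ c))
    (λ T → lowerCandidate T , upper (close-between-inst¹ F β γ π₀ π₁ (lowerCandidate T)))

_[_↦_] : (ℕ → ℕ) → ℕ → ℕ → ℕ → ℕ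
(π₀ [ a ↦ n ]) b with b ≟ a
... | yes _ = n
... | no _  = π₀ b

[↦]-here : (π₀ : ℕ → ℕ) (a n : ℕ) → (π₀ [ a ↦ n ]) a ≡ n
[↦]-here π₀ a n with a ≟ a
... | yes _  = refl
... | no a≢a = ⊥-elim (a≢a refl)

[↦]-other : (π₀ : ℕ → ℕ) (a n b : ℕ) → ¬ b ≡ a → (π₀ [ a ↦ n ]) b ≡ π₀ b
[↦]-other π₀ a n b b≢a with b ≟ a
... | yes b≡a = ⊥-elim (b≢a b≡a)
... | no _    = refl

module Soundness (B : CompleteBooleanAlgebra) (SV : SemiValuation B) where
  open CompleteBooleanAlgebraProperties B
  open Intervals B
  open SemiValuation SV
  open Semantics B SV

  _[_,_↦_]ᶜ : FreeCandidates → (k y : ℕ) → Candidate k → FreeCandidates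
  (π₁ [ k , y ↦ c ]ᶜ) j x with j ≟ k | x ≟ y
  ... | yes refl | yes _ = c
  ... | _        | _     = π₁ j x

  [↦]ᶜ-here : (π₁ : FreeCandidates) (k y : ℕ) (c : Candidate k) → (π₁ [ k , y ↦ c ]ᶜ) k y ≡ c
  [↦]ᶜ-here π₁ k y c with k ≟ k | y ≟ y
  ... | yes refl | yes _  = refl
  ... | yes refl | no y≢y = ⊥-elim (y≢y refl)
  ... | no k≢k   | _      = ⊥-elim (k≢k refl)

  [↦]ᶜ-other : (π₁ : FreeCandidates) (k y : ℕ) (c : Candidate k) (j x : ℕ) →
    ¬ (j ≡ k × x ≡ y) → (π₁ [ k , y ↦ c ]ᶜ) j x ≡ π₁ j x
  [↦]ᶜ-other π₁ k y c j x ≢ with j ≟ k | x ≟ y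
  ... | yes refl | yes x≡y = ⊥-elim (≢ (refl , x≡y))
  ... | yes refl | no _    = refl
  ... | no _     | _       = refl

  ⟦_⟧₀ : Fm → (ℕ → ℕ) → FreeCandidates → Carrier
  ⟦ A ⟧₀ π₀ π₁ = ⟦ A ⟧ᶜ []ᶠ []ᶜ π₀ π₁

  ⋀⟦_⟧ ⋁⟦_⟧ : List Fm → (ℕ → ℕ) → FreeCandidates → Carrier
  ⋀⟦ Γ ⟧ π₀ π₁ = ⋀ λ (A : Σ Fm (_∈ Γ)) → ⟦ proj₁ A ⟧₀ π₀ π₁
  ⋁⟦ Δ ⟧ π₀ π₁ = ⋁ λ (A : Σ Fm (_∈ Δ)) → ⟦ proj₁ A ⟧₀ π₀ π₁

  module _ {π₀ : ℕ → ℕ} {π₁ : FreeCandidates} where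

    ⋀⟦⟧-∈ : {Γ : List Fm} {A : Fm} → A ∈ Γ → ⋀⟦ Γ ⟧ π₀ π₁ ≤ ⟦ A ⟧₀ π₀ π₁
    ⋀⟦⟧-∈ {A = A} A∈Γ = ⋀-lb _ (A , A∈Γ)

    ⋁⟦⟧-∈ : {Δ : List Fm} {A : Fm} → A ∈ Δ → ⟦ A ⟧₀ π₀ π₁ ≤ ⋁⟦ Δ ⟧ π₀ π₁
    ⋁⟦⟧-∈ {A = A} A∈Δ = ⋁-ub _ (A , A∈Δ)

    ⋀⟦⟧-∷ : {Γ : List Fm} {A : Fm} → ⋀⟦ Γ ⟧ π₀ π₁ ⊓ ⟦ A ⟧₀ π₀ π₁ ≤ ⋀⟦ A ∷ Γ ⟧ π₀ π₁
    ⋀⟦⟧-∷ = ⋀-glb _ _ λ { (_ , here refl) → ⊓-lb₂ _ _ ; (A , there A∈Γ) → ⊓-lb₁ _ _ ∙ ⋀⟦⟧-∈ A∈Γ }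

    ⋁⟦⟧-∷ : {Δ : List Fm} {A : Fm} → ⋁⟦ A ∷ Δ ⟧ π₀ π₁ ≤ ⟦ A ⟧₀ π₀ π₁ ⊔ ⋁⟦ Δ ⟧ π₀ π₁
    ⋁⟦⟧-∷ = ⋁-lub _ _ λ { (_ , here refl) → ⊔-ub₁ _ _ ; (A , there A∈Δ) → ⋁⟦⟧-∈ A∈Δ ∙ ⊔-ub₂ _ _ }

    ⋀⟦⟧-⊆ : {Γ Γ' : List Fm} → Γ' ⊆ Γ → ⋀⟦ Γ ⟧ π₀ π₁ ≤ ⋀⟦ Γ' ⟧ π₀ π₁
    ⋀⟦⟧-⊆ Γ'⊆Γ = ⋀-glb _ _ λ { (A , A∈Γ') → ⋀⟦⟧-∈ (Γ'⊆Γ A∈Γ') }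

    ⋁⟦⟧-⊆ : {Δ Δ' : List Fm} → Δ' ⊆ Δ → ⋁⟦ Δ' ⟧ π₀ π₁ ≤ ⋁⟦ Δ ⟧ π₀ π₁
    ⋁⟦⟧-⊆ Δ'⊆Δ = ⋁-lub _ _ λ { (A , A∈Δ') → ⋁⟦⟧-∈ (Δ'⊆Δ A∈Δ') }

    ⟦⟧₀-inst⁰ : (F : Formula 1 []) (t : ℕ) → ⟦ inst⁰ F t ⟧₀ π₀ π₁ ≈ ⟦ F ⟧ᶜ (π₀ t ∷ᶠ []ᶠ) []ᶜ π₀ π₁
    ⟦⟧₀-inst⁰ F t = Eq.trans (⟦⟧-subst⁰ (λ _ → fv t) F []ᶠ _ π₀ _)
      (⟦⟧-cong-bound F (λ { zero → refl }) (λ ()))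

    ⟦⟧₀-inst¹ : {k : ℕ} (F : Formula 0 (k ∷ [])) (T : Abs k) → ⟦ inst¹ F T ⟧₀ π₀ π₁ ≈
      ⟦ F ⟧ []ᶠ ((λ v → ⟦ T ⟧ᶜ (lookup v) []ᶜ π₀ π₁) ∷ᵃ (λ p → extent ([]ᶜ p))) π₀ π₁
    ⟦⟧₀-inst¹ F T = Eq.trans (⟦⟧-sub¹ _ F []ᶠ _ π₀ _)
      (⟦⟧-cong-bound F (λ ()) λ { (here refl) v → ⟦⟧-cong-bound T (λ i → refl) (λ ()) })

    ⋀⟦⟧-∈-⊓ : {Γ : List Fm} {A : Fm} → A ∈ Γ → ⋀⟦ Γ ⟧ π₀ π₁ ≤ ⋀⟦ Γ ⟧ π₀ π₁ ⊓ ⟦ A ⟧₀ π₀ π₁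
    ⋀⟦⟧-∈-⊓ A∈Γ = ⊓-glb _ _ _ ≤-refl (⋀⟦⟧-∈ A∈Γ)

    ⋁⟦⟧-∈-⊔ : {Δ : List Fm} {A : Fm} → A ∈ Δ → ⟦ A ⟧₀ π₀ π₁ ⊔ ⋁⟦ Δ ⟧ π₀ π₁ ≤ ⋁⟦ Δ ⟧ π₀ π₁
    ⋁⟦⟧-∈-⊔ A∈Δ = ⊔-lub _ _ _ (⋁⟦⟧-∈ A∈Δ) ≤-refl

    -- Comprehension: the value of every abstract is a candidate.
    candidateOf : {k : ℕ} → Abs k → Candidate k
    candidateOf T = record
      { term   = G
      ; extent = λ v → ⟦ T ⟧ᶜ (lookup v) []ᶜ π₀ π₁
      ; bounds = λ v → subst (λ A → Between (V A) (⟦ T ⟧ᶜ (lookup v) []ᶜ π₀ π₁))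
                         (sym (apply-G v)) (close-between T (lookup v) []ᶜ π₀ π₁)
      }
      where
      G = substAll bv (λ p → abs (term ([]ᶜ p))) π₀ (λ k x → term (π₁ k x)) T

      apply-G : ∀ v → apply (abs G) (map fv v) ≡ close (lookup v) []ᶜ π₀ π₁ T
      apply-G v = trans (ren¹-id (λ ()) _) (trans (subst⁰-substAll (lookup (map fv v)) bv _ π₀ _ T)
        (substAll-cong π₀ _ (λ i → lookup-map i fv v) (λ p → refl) T))

  module _ {π₀ : ℕ → ℕ} {π₁ : FreeCandidates} {a n : ℕ} where

    ⟦⟧₀-fresh⁰ : (A : Fm) → ¬ occ⁰ a A → ⟦ A ⟧₀ (π₀ [ a ↦ n ]) π₁ ≈ ⟦ A ⟧₀ π₀ π₁
    ⟦⟧₀-fresh⁰ A a∉A = ⟦⟧-cong A (λ ()) (λ ())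
      (λ b b∈A → [↦]-other π₀ a n b λ { refl → a∉A b∈A }) (λ k x o v → Eq.refl)

    ⋀⟦⟧-fresh⁰ : {Γ : List Fm} → All (λ A → ¬ occ⁰ a A) Γ → ⋀⟦ Γ ⟧ (π₀ [ a ↦ n ]) π₁ ≈ ⋀⟦ Γ ⟧ π₀ π₁
    ⋀⟦⟧-fresh⁰ a∉Γ = ⋀-cong λ { (A , A∈Γ) → ⟦⟧₀-fresh⁰ A (All-lookup a∉Γ A∈Γ) }

    ⋁⟦⟧-fresh⁰ : {Δ : List Fm} → All (λ A → ¬ occ⁰ a A) Δ → ⋁⟦ Δ ⟧ (π₀ [ a ↦ n ]) π₁ ≈ ⋁⟦ Δ ⟧ π₀ π₁
    ⋁⟦⟧-fresh⁰ a∉Δ = ⋁-cong λ { (A , A∈Δ) → ⟦⟧₀-fresh⁰ A (All-lookup a∉Δ A∈Δ) }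

    ⟦⟧₀-inst⁰-fresh : (F : Formula 1 []) → ¬ occ⁰ a F →
      ⟦ inst⁰ F a ⟧₀ (π₀ [ a ↦ n ]) π₁ ≈ ⟦ F ⟧ᶜ (n ∷ᶠ []ᶠ) []ᶜ π₀ π₁
    ⟦⟧₀-inst⁰-fresh F a∉F = Eq.trans (⟦⟧₀-inst⁰ F a) (⟦⟧-cong F (λ { zero → [↦]-here π₀ a n }) (λ ())
      (λ b b∈F → [↦]-other π₀ a n b λ { refl → a∉F b∈F }) (λ k x o v → Eq.refl))

  module _ {π₀ : ℕ → ℕ} {π₁ : FreeCandidates} {k y : ℕ} {c : Candidate k} where

    ⟦⟧₀-fresh¹ : (A : Fm) → ¬ occ¹ k y A → ⟦ A ⟧₀ π₀ (π₁ [ k , y ↦ c ]ᶜ) ≈ ⟦ A ⟧₀ π₀ π₁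
    ⟦⟧₀-fresh¹ A y∉A = ⟦⟧-cong A (λ ()) (λ ()) (λ b o → refl)
      (λ j x o v → Eq.reflexive (cong (λ c' → extent c' v)
        ([↦]ᶜ-other π₁ k y c j x λ { (refl , refl) → y∉A o })))

    ⋀⟦⟧-fresh¹ : {Γ : List Fm} → All (λ A → ¬ occ¹ k y A) Γ →
      ⋀⟦ Γ ⟧ π₀ (π₁ [ k , y ↦ c ]ᶜ) ≈ ⋀⟦ Γ ⟧ π₀ π₁
    ⋀⟦⟧-fresh¹ y∉Γ = ⋀-cong λ { (A , A∈Γ) → ⟦⟧₀-fresh¹ A (All-lookup y∉Γ A∈Γ) }

    ⋁⟦⟧-fresh¹ : {Δ : List Fm} → All (λ A → ¬ occ¹ k y A) Δ →
      ⋁⟦ Δ ⟧ π₀ (π₁ [ k , y ↦ c ]ᶜ) ≈ ⋁⟦ Δ ⟧ π₀ π₁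
    ⋁⟦⟧-fresh¹ y∉Δ = ⋁-cong λ { (A , A∈Δ) → ⟦⟧₀-fresh¹ A (All-lookup y∉Δ A∈Δ) }

    ⟦⟧₀-inst¹-fresh : (F : Formula 0 (k ∷ [])) → ¬ occ¹ k y F →
      ⟦ inst¹ F (varAbs k y) ⟧₀ π₀ (π₁ [ k , y ↦ c ]ᶜ) ≈
      ⟦ F ⟧ []ᶠ (extent c ∷ᵃ (λ p → extent ([]ᶜ p))) π₀ π₁
    ⟦⟧₀-inst¹-fresh F y∉F = Eq.trans (⟦⟧₀-inst¹ F (varAbs k y)) (⟦⟧-cong F (λ ())
      (λ { (here refl) v → Eq.reflexive (cong₂ extent ([↦]ᶜ-here π₁ k y c)
                                               (map-allBv (evalT (lookup v) π₀) v (λ i → refl))) })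
      (λ b o → refl)
      (λ j x o v → Eq.reflexive (cong (λ c' → extent c' v)
        ([↦]ᶜ-other π₁ k y c j x λ { (refl , refl) → y∉F o }))))

  Valid : List Fm → List Fm → Set
  Valid Γ Δ = ∀ π₀ π₁ → ⋀⟦ Γ ⟧ π₀ π₁ ≤ ⋁⟦ Δ ⟧ π₀ π₁

  module _ {Γ Δ : List Fm} where

    L∃⁰-valid : {F : Formula 1 []} → ∃⁰ F ∈ Γ → (a : ℕ) → fresh⁰ a Γ Δ →
      Valid (inst⁰ F a ∷ Γ) Δ → Valid Γ Δ
    L∃⁰-valid {F} p a (a∉Γ , a∉Δ) premise π₀ π₁ = ⋀⟦⟧-∈-⊓ p ∙ ⊓-⋁-lub λ n →
      ⊓-mono (≈⇒≥ (⋀⟦⟧-fresh⁰ a∉Γ)) (≈⇒≥ (⟦⟧₀-inst⁰-fresh F (All-lookup a∉Γ p)))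
      ∙ ⋀⟦⟧-∷ ∙ premise (π₀ [ a ↦ n ]) π₁ ∙ reflexive (⋁⟦⟧-fresh⁰ a∉Δ)

    R∀⁰-valid : {F : Formula 1 []} → ∀⁰ F ∈ Δ → (a : ℕ) → fresh⁰ a Γ Δ →
      Valid Γ (inst⁰ F a ∷ Δ) → Valid Γ Δ
    R∀⁰-valid {F} p a (a∉Γ , a∉Δ) premise π₀ π₁ = ⋀-⊔-glb (λ n →
      ≈⇒≥ (⋀⟦⟧-fresh⁰ a∉Γ) ∙ premise (π₀ [ a ↦ n ]) π₁ ∙ ⋁⟦⟧-∷
      ∙ ⊔-mono (reflexive (⟦⟧₀-inst⁰-fresh F (All-lookup a∉Δ p))) (reflexive (⋁⟦⟧-fresh⁰ a∉Δ)))
      ∙ ⋁⟦⟧-∈-⊔ p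

    L∃¹-valid : {k : ℕ} {F : Formula 0 (k ∷ [])} → ∃¹ k F ∈ Γ → (y : ℕ) → fresh¹ k y Γ Δ →
      Valid (inst¹ F (varAbs k y) ∷ Γ) Δ → Valid Γ Δ
    L∃¹-valid {k} {F} p y (y∉Γ , y∉Δ) premise π₀ π₁ = ⋀⟦⟧-∈-⊓ p ∙ ⊓-⋁-lub λ c →
      ⊓-mono (≈⇒≥ (⋀⟦⟧-fresh¹ y∉Γ)) (≈⇒≥ (⟦⟧₀-inst¹-fresh F (All-lookup y∉Γ p)))
      ∙ ⋀⟦⟧-∷ ∙ premise π₀ (π₁ [ k , y ↦ c ]ᶜ) ∙ reflexive (⋁⟦⟧-fresh¹ y∉Δ)

    R∀¹-valid : {k : ℕ} {F : Formula 0 (k ∷ [])} → ∀¹ k F ∈ Δ → (y : ℕ) → fresh¹ k y Γ Δ →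
      Valid Γ (inst¹ F (varAbs k y) ∷ Δ) → Valid Γ Δ
    R∀¹-valid {k} {F} p y (y∉Γ , y∉Δ) premise π₀ π₁ = ⋀-⊔-glb (λ c →
      ≈⇒≥ (⋀⟦⟧-fresh¹ y∉Γ) ∙ premise π₀ (π₁ [ k , y ↦ c ]ᶜ) ∙ ⋁⟦⟧-∷
      ∙ ⊔-mono (reflexive (⟦⟧₀-inst¹-fresh F (All-lookup y∉Δ p))) (reflexive (⋁⟦⟧-fresh¹ y∉Δ)))
      ∙ ⋁⟦⟧-∈-⊔ p

  sound : {Γ Δ : List Fm} → Γ ⊢ Δ → Valid Γ Δ
  sound (init A _ A∈Γ A∈Δ) π₀ π₁ = ⋀⟦⟧-∈ A∈Γ ∙ ⋁⟦⟧-∈ A∈Δ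
  sound (L¬ p d)      π₀ π₁ = ⋀⟦⟧-∈-⊓ p ∙ disjunctive-syllogism (sound d π₀ π₁ ∙ ⋁⟦⟧-∷)
  sound (R¬ p d)      π₀ π₁ = ≤-by-cases (⋀⟦⟧-∷ ∙ sound d π₀ π₁) (⊓-lb₂ _ _ ∙ ⋁⟦⟧-∈ p)
  sound (L∨ p d₀ d₁)  π₀ π₁ = ⋀⟦⟧-∈-⊓ p ∙ ⊓-⊔-lub (⋀⟦⟧-∷ ∙ sound d₀ π₀ π₁) (⋀⟦⟧-∷ ∙ sound d₁ π₀ π₁)
  sound (R∨₀ p d)     π₀ π₁ = sound d π₀ π₁ ∙ ⋁⟦⟧-∷ ∙ ⊔-mono (⊔-ub₁ _ _) ≤-refl ∙ ⋁⟦⟧-∈-⊔ p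
  sound (R∨₁ p d)     π₀ π₁ = sound d π₀ π₁ ∙ ⋁⟦⟧-∷ ∙ ⊔-mono (⊔-ub₂ _ _) ≤-refl ∙ ⋁⟦⟧-∈-⊔ p
  sound (L∧₀ p d)     π₀ π₁ = ⋀⟦⟧-∈-⊓ p ∙ ⊓-mono ≤-refl (⊓-lb₁ _ _) ∙ ⋀⟦⟧-∷ ∙ sound d π₀ π₁
  sound (L∧₁ p d)     π₀ π₁ = ⋀⟦⟧-∈-⊓ p ∙ ⊓-mono ≤-refl (⊓-lb₂ _ _) ∙ ⋀⟦⟧-∷ ∙ sound d π₀ π₁
  sound (R∧ p d₀ d₁)  π₀ π₁ = ⊔-⊓-glb (sound d₀ π₀ π₁ ∙ ⋁⟦⟧-∷) (sound d₁ π₀ π₁ ∙ ⋁⟦⟧-∷) ∙ ⋁⟦⟧-∈-⊔ p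
  sound (L∃⁰ p a fr d) = L∃⁰-valid p a fr (sound d)
  sound (R∀⁰ p a fr d) = R∀⁰-valid p a fr (sound d)
  sound (L∃¹ p y fr d) = L∃¹-valid p y fr (sound d)
  sound (R∀¹ p y fr d) = R∀¹-valid p y fr (sound d)
  sound (R∃⁰ {F = F} p t d) π₀ π₁ = sound d π₀ π₁ ∙ ⋁⟦⟧-∷ ∙
    ⊔-mono (reflexive (⟦⟧₀-inst⁰ F t) ∙ ⋁-ub _ (π₀ t)) ≤-refl ∙ ⋁⟦⟧-∈-⊔ p
  sound (L∀⁰ {F = F} p t d) π₀ π₁ = ⋀⟦⟧-∈-⊓ p ∙
    ⊓-mono ≤-refl (⋀-lb _ (π₀ t) ∙ ≈⇒≥ (⟦⟧₀-inst⁰ F t)) ∙ ⋀⟦⟧-∷ ∙ sound d π₀ π₁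
  sound (R∃¹ {F = F} p T d) π₀ π₁ = sound d π₀ π₁ ∙ ⋁⟦⟧-∷ ∙
    ⊔-mono (reflexive (⟦⟧₀-inst¹ F T) ∙ ⋁-ub _ (candidateOf T)) ≤-refl ∙ ⋁⟦⟧-∈-⊔ p
  sound (L∀¹ {F = F} p T d) π₀ π₁ = ⋀⟦⟧-∈-⊓ p ∙
    ⊓-mono ≤-refl (⋀-lb _ (candidateOf T) ∙ ≈⇒≥ (⟦⟧₀-inst¹ F T)) ∙ ⋀⟦⟧-∷ ∙ sound d π₀ π₁
  sound (cut {Γ₁ = Γ₁} {Δ₁ = Δ₁} C d₁ d₂ (_ , Γ₁++Γ₂⊆Γ) (_ , Δ₁++Δ₂⊆Δ)) π₀ π₁ = cut-≤
    (⋀⟦⟧-⊆ (λ q → Γ₁++Γ₂⊆Γ (∈-++⁺ˡ q)) ∙ sound d₁ π₀ π₁ ∙ ⋁⟦⟧-∷ ∙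
      ⊔-mono ≤-refl (⋁⟦⟧-⊆ (λ q → Δ₁++Δ₂⊆Δ (∈-++⁺ˡ q))))
    (⊓-mono (⋀⟦⟧-⊆ (λ q → Γ₁++Γ₂⊆Γ (∈-++⁺ʳ Γ₁ q))) ≤-refl ∙ ⋀⟦⟧-∷ ∙ sound d₂ π₀ π₁ ∙
      ⋁⟦⟧-⊆ (λ q → Δ₁++Δ₂⊆Δ (∈-++⁺ʳ Δ₁ q)))

  identityCandidates : FreeCandidates
  identityCandidates k x = lowerCandidate (varAbs k x)

  V-between : (A : Fm) → Between (V A) (⟦ A ⟧₀ id identityCandidates)
  V-between A = subst (λ A' → Between (V A') (⟦ A ⟧₀ id identityCandidates))
    (substAll-id (λ ()) (λ ()) A) (close-between A []ᶠ []ᶜ id identityCandidates)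

  ⊢⇒□≤◇ : {Γ Δ : List Fm} → Γ ⊢ Δ →
    ⋀ (λ (A : Σ Fm (_∈ Γ)) → □ (V (proj₁ A))) ≤ ⋁ (λ (C : Σ Fm (_∈ Δ)) → ◇ (V (proj₁ C)))
  ⊢⇒□≤◇ Γ⊢Δ = ⋀-mono (λ A → lower (V-between (proj₁ A)))
    ∙ sound Γ⊢Δ id identityCandidates
    ∙ ⋁-mono (λ C → upper (V-between (proj₁ C)))

open CompleteBooleanAlgebra using (_≤_; ⋀; ⋁)

theorem2p9 : (Γ Δ : List Fm) → Γ ⊢ Δ →
    (B : CompleteBooleanAlgebra) (V : SemiValuation B) →
    _≤_ B (⋀ B (λ (A : Σ Fm (λ A → A ∈ Γ)) → □ (SemiValuation.V V (proj₁ A))))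
          (⋁ B (λ (C : Σ Fm (λ C → C ∈ Δ)) → ◇ (SemiValuation.V V (proj₁ C))))
theorem2p9 Γ Δ Γ⊢Δ B V = Soundness.⊢⇒□≤◇ B V Γ⊢Δ
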